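{- Let $p$ be a prime, $m\ge1$, and let $(\mathcal C_\star):(\mathcal C_i)_{i=0}^{m-1}$ and $(\mathcal D_\star):(\mathcal D_i)_{i=0}^{m-1}$ be two chains, both of cyclic codes in $\mathbb F_p^n$ or both of extended cyclic codes in $\mathbb F_p^{n+1}$, with $\mathcal C_i\subseteq\mathcal D_i$ for $0\le i\le m-1$ and $\mathcal D_i\subseteq\mathcal C_{i+1}$ for $0\le i\le m-2$. Then as $\mathbb F_p[\sigma]$-modules $$\mathcal L(\widehat{(\mathcal D_\star)})/\mathcal L(\widehat{(\mathcal C_\star)})\cong\widehat{(\mathcal D_\star)}/\widehat{(\mathcal C_\star)}\cong\mathcal D_0/\mathcal C_0\oplus\mathcal D_1/\mathcal C_1\oplus\dots\oplus\mathcal D_{m-1}/\mathcal C_{m-1}.$$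
   Context: Let $R=\mathbb Z/p^m\mathbb Z$, $n\ge1$ with $p\nmid n$. Identify $\mathbb F_p[X]/(X^n-1)\cong\mathbb F_p^n$ and $R[X]/(X^n-1)\cong R^n$ via $1,X,\dots,X^{n-1}$; cyclic codes are ideals of $\mathbb F_p[X]/(X^n-1)$; $\sigma$ is multiplication by $X$ (cyclic shift), extended to fix the extra coordinate in the extended case. Each monic generator polynomial $g\mid X^n-1$ has a unique monic lift $G\mid X^n-1$ in $R[X]$ with $G\equiv g\pmod p$ (Hensel). The lift of a chain of cyclic codes with generator polynomials $g_j$ is the ideal $(p^jG_j:0\le j\le m-1)$ of $R[X]/(X^n-1)$. The extended code of $\mathcal C\subseteq A^n$ is $\{(c_1,\dots,c_n,-\sum c_i)\}$; for a chain of extended cyclic codes the lift is the extended code of the lift of the underlying chain of cyclic codes. With $N=n$ (cyclic) or $N=n+1$ (extended), $b_1,\dots,b_N$ an orthogonal basis of $\mathbb R^N$ with $(b_i,b_i)=p^{ -m}$ and $\sigma$ permuting the $b_i$ like the coordinates, $\mathcal L(\widehat{(\mathcal C_\star)})=\{\sum a_ib_i:a_i\in\mathbb Z,(a_i+p^m\mathbb Z)_i\in\widehat{(\mathcal C_\star)}\}$. -}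

module Defs where

open import Data.Nat as ℕ using (ℕ; zero; suc; _∸_; _%_; _≡ᵇ_; NonZero; _<_)
open import Data.Nat.DivMod using (m%n<n)
open import Data.Integer as ℤ using (ℤ; +_; 0ℤ; 1ℤ; -1ℤ; _-_)
open import Data.Integer.Divisibility as ℤD using ()
open import Data.Fin using (Fin; toℕ; fromℕ<; fromℕ; inject₁)
open import Data.List using (List; length)
open import Data.List.Base as L using ()
open import Data.Bool using (if_then_else_)
open import Data.Product using (Σ; _×_; ∃)
open import Relation.Nullary using (yes; no)
open import Relation.Binary.PropositionalEquality using (_≡_)

-- Integers modulo q.  Elements of Z/qZ (q = p or q = p^m) are represented
-- by integers; equality in Z/qZ is congruence modulo q.

_≡_[mod_] : ℤ → ℤ → ℕ → Set
a ≡ b [mod q ] = (+ q) ℤD.∣ (a - b)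

Vecℤ : ℕ → Set
Vecℤ N = Fin N → ℤ

_≡v_[mod_] : {N : ℕ} → Vecℤ N → Vecℤ N → ℕ → Set
x ≡v y [mod q ] = ∀ i → x i ≡ y i [mod q ]

_+v_ : {N : ℕ} → Vecℤ N → Vecℤ N → Vecℤ N
(x +v y) i = x i ℤ.+ y i

_-v_ : {N : ℕ} → Vecℤ N → Vecℤ N → Vecℤ N
(x -v y) i = x i ℤ.- y i

_·v_ : {N : ℕ} → ℤ → Vecℤ N → Vecℤ N
(k ·v x) i = k ℤ.* x i

0v : {N : ℕ} → Vecℤ N
0v i = 0ℤ

sumℕ : ℕ → (ℕ → ℤ) → ℤ
sumℕ zero f = 0ℤ
sumℕ (suc k) f = sumℕ k f ℤ.+ f k

sumFin : (k : ℕ) → (Fin k → ℤ) → ℤ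
sumFin zero f = 0ℤ
sumFin (suc k) f = f Fin.zero ℤ.+ sumFin k (λ i → f (Fin.suc i))

-- Polynomials with integer coefficients (coefficient lists, constant
-- term first), read modulo q where needed.

coeff : List ℤ → ℕ → ℤ
coeff List.[] k = 0ℤ
coeff (a List.∷ f) zero = a
coeff (a List.∷ f) (suc k) = coeff f k

mulCoeff : List ℤ → List ℤ → ℕ → ℤ
mulCoeff f h k = sumℕ (suc k) (λ i → coeff f i ℤ.* coeff h (k ∸ i))

xⁿ-1 : ℕ → ℕ → ℤ
xⁿ-1 n k = if k ≡ᵇ n then 1ℤ else (if k ≡ᵇ 0 then -1ℤ else 0ℤ)

MonicMod : ℕ → List ℤ → Set
MonicMod q f = Σ ℕ λ d → (coeff f d ≡ 1ℤ [mod q ]) × (∀ k → d < k → coeff f k ≡ 0ℤ [mod q ])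

DividesMod : ℕ → List ℤ → (ℕ → ℤ) → Set
DividesMod q f t = Σ (List ℤ) λ h → ∀ k → mulCoeff f h k ≡ t k [mod q ]

-- The ring A[X]/(X^n - 1) identified with A^n via 1, X, ..., X^{n-1}.

module _ (n : ℕ) .{{_ : NonZero n}} where

  cyc : ℕ → Fin n
  cyc t = fromℕ< (m%n<n t n)

  reduce : List ℤ → Vecℤ n
  reduce f k = sumℕ (length f) (λ i → if (i % n) ≡ᵇ toℕ k then coeff f i else 0ℤ)

  -- multiplication in A[X]/(X^n-1) (cyclic convolution)
  conv : Vecℤ n → Vecℤ n → Vecℤ n
  conv a b k = sumFin n (λ i → a i ℤ.* b (cyc (toℕ k ℕ.+ n ∸ toℕ i)))

  -- σ : multiplication by X (cyclic shift)
  σcyc : Vecℤ n → Vecℤ n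
  σcyc x k = x (cyc (toℕ k ℕ.+ n ∸ 1))

  σext : Vecℤ (suc n) → Vecℤ (suc n)
  σext x k with toℕ k ℕ.<? n
  ... | yes _ = x (inject₁ (cyc (toℕ k ℕ.+ n ∸ 1)))
  ... | no  _ = x k

Code : ℕ → Set₁
Code N = Vecℤ N → Set

_⊆_ : {N : ℕ} → Code N → Code N → Set
C ⊆ D = ∀ x → C x → D x

-- A cyclic code over F_p: an ideal of F_p[X]/(X^n-1) ≅ F_p^n, i.e. a subset
-- well defined mod p, containing 0, closed under +, under multiplication
-- by scalars and under multiplication by X.
record IsCyclicCode (p n : ℕ) .{{_ : NonZero n}} (C : Code n) : Set where
  field
    respects : ∀ x y → x ≡v y [mod p ] → C x → C y
    zero∈    : C 0v
    +-closed : ∀ x y → C x → C y → C (x +v y)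
    ·-closed : ∀ k x → C x → C (k ·v x)
    σ-closed : ∀ x → C x → C (σcyc n x)

IsGeneratorPoly : (p n : ℕ) .{{_ : NonZero n}} → Code n → List ℤ → Set
IsGeneratorPoly p n C g =
  MonicMod p g × DividesMod p g (xⁿ-1 n) ×
  (∀ x → (C x → Σ (Vecℤ n) λ h → x ≡v conv n (reduce n g) h [mod p ]) ×
         (Σ (Vecℤ n) (λ h → x ≡v conv n (reduce n g) h [mod p ]) → C x))

IsHenselLift : (p m n : ℕ) → List ℤ → List ℤ → Set
IsHenselLift p m n g G =
  MonicMod (p ℕ.^ m) G × DividesMod (p ℕ.^ m) G (xⁿ-1 n) ×
  (∀ k → coeff G k ≡ coeff g k [mod p ])

liftCode : (p m n : ℕ) .{{_ : NonZero n}} → (Fin m → List ℤ) → Code n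
liftCode p m n G x =
  Σ (Fin m → Vecℤ n) λ h →
    x ≡v (λ k → sumFin m (λ j → (+ (p ℕ.^ toℕ j)) ℤ.* conv n (reduce n (G j)) (h j) k)) [mod p ℕ.^ m ]

data Kind : Set where
  cyclic extended : Kind

Len : Kind → ℕ → ℕ
Len cyclic n = n
Len extended n = suc n

extCode : (q n : ℕ) → Code n → Code (suc n)
extCode q n C v = C (λ i → v (inject₁ i)) × (v (fromℕ n) ≡ ℤ.- sumFin n (λ i → v (inject₁ i)) [mod q ])

codeOf : (κ : Kind) (q n : ℕ) → Code n → Code (Len κ n)
codeOf cyclic q n C = C
codeOf extended q n C = extCode q n C

σ : (κ : Kind) (n : ℕ) .{{_ : NonZero n}} → Vecℤ (Len κ n) → Vecℤ (Len κ n)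
σ cyclic n = σcyc n
σ extended n = σext n

-- Quotient modules (ℤ[σ]-modules; the ones below are killed by p, so
-- they are F_p[σ]-modules).  A quotient B/A of submodules of an ambient
-- module is given by the ambient carrier, membership in B, the relation
-- x ≈ y :⇔ x - y ∈ A, and the module operations.

record QMod : Set₁ where
  field
    Carrier : Set
    In      : Carrier → Set
    _≈_     : Carrier → Carrier → Set
    _⊕_     : Carrier → Carrier → Carrier
    _⊙_     : ℤ → Carrier → Carrier
    act     : Carrier → Carrier

quotient : (N : ℕ) → (Vecℤ N → Vecℤ N) → (B A : Code N) → QMod
quotient N s B A = record
  { Carrier = Vecℤ N ; In = B ; _≈_ = λ x y → A (x -v y)
  ; _⊕_ = _+v_ ; _⊙_ = _·v_ ; act = s }

directSum : (m N : ℕ) → (Vecℤ N → Vecℤ N) → (B A : Fin m → Code N) → QMod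
directSum m N s B A = record
  { Carrier = Fin m → Vecℤ N
  ; In = λ x → ∀ j → B j (x j)
  ; _≈_ = λ x y → ∀ j → A j (x j -v y j)
  ; _⊕_ = λ x y j → x j +v y j
  ; _⊙_ = λ k x j → k ·v x j
  ; act = λ x j → s (x j) }

record Iso (M M' : QMod) : Set where
  private module M = QMod M
  private module M' = QMod M'
  field
    f    : (x : M.Carrier) → M.In x → M'.Carrier
    mem  : ∀ x (hx : M.In x) → M'.In (f x hx)
    resp : ∀ x y (hx : M.In x) (hy : M.In y) → M._≈_ x y → M'._≈_ (f x hx) (f y hy)
    inj  : ∀ x y (hx : M.In x) (hy : M.In y) → M'._≈_ (f x hx) (f y hy) → M._≈_ x y
    surj : ∀ y → M'.In y → Σ M.Carrier λ x → Σ (M.In x) λ hx → M'._≈_ (f x hx) y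
    add  : ∀ x y (hx : M.In x) (hy : M.In y) (hxy : M.In (M._⊕_ x y)) →
             M'._≈_ (f (M._⊕_ x y) hxy) (M'._⊕_ (f x hx) (f y hy))
    scal : ∀ k x (hx : M.In x) (hkx : M.In (M._⊙_ k x)) →
             M'._≈_ (f (M._⊙_ k x) hkx) (M'._⊙_ k (f x hx))
    equi : ∀ x (hx : M.In x) (hσx : M.In (M.act x)) →
             M'._≈_ (f (M.act x) hσx) (M'.act (f x hx))

-- The lattice L(P) = {Σ a_i b_i : a_i ∈ ℤ, (a_i mod p^m) ∈ P}, represented
-- by its coordinate vectors a ∈ ℤ^N w.r.t. the orthogonal basis b_i
-- (a ↦ Σ a_i b_i is a σ-equivariant group isomorphism onto the lattice).
lattice : {N : ℕ} → Code N → Vecℤ N → Set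
lattice P a = P a

module Submission where

-- Work in R = ℤ[X]/(Xⁿ − 1), realised on coefficient vectors, with congruences modulo powers of
-- P = p.  Because p ∤ n, n is a unit modulo p, and for a Hensel lift G with cofactor L
-- (G L ≡ Xⁿ − 1 mod pᵐ) the identity X (G L)′ ≡ n (mod Xⁿ − 1, pᵐ) turns the product rule into a
-- Bezout relation α G + β L ≡ n (mod p).  Hence the annihilator of L modulo pᵉ is (G), and a
-- divisibility between generators modulo p lifts to the Hensel lifts modulo pᵐ.
-- With these, Σ pʲ Hⱼ cⱼ lies in the lift (pʲ Gⱼ : j) iff every Hⱼ cⱼ lies in (Gⱼ) modulo p: multiplying
-- by Lⱼ isolates the j-th summand modulo pʲ⁺¹, and conversely one splits off the Gⱼ-part of Hⱼ cⱼ and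
-- pushes the remainder, which lies in (Hⱼ) ⊆ (Gⱼ₊₁) modulo p, to level j + 1.  So
-- x = Σ pʲ Hⱼ cⱼ ↦ (Hⱼ cⱼ)ⱼ is a well-defined, injective, surjective σ-equivariant module map.
-- The extended case follows by appending the parity coordinate, and the lattice L(𝒞) is described
-- by the same coordinate vectors, so the first isomorphism is the identity.

open import Defs
open import Level using (0ℓ)
open import Algebra.Bundles using (CommutativeRing; RawRing)
open import Algebra.Structures using (IsCommutativeRing)
open import Algebra.Solver.Ring.AlmostCommutativeRing using (_-Raw-AlmostCommutative⟶_; fromCommutativeRing)
import Algebra.Construct.Pointwise as Pointwise
import Algebra.Properties.Semiring.Sum as SemiringSum
open import Data.Bool using (true; false; if_then_else_; T)
open import Data.Empty using (⊥-elim)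
open import Data.Fin as Fin using (Fin; toℕ; fromℕ<; inject₁; fromℕ)
import Data.Fin.Properties as Fin
open import Data.Fin.Permutation as Perm using (Permutation′; permutation)
open import Data.Integer as ℤ using (ℤ; +_; 0ℤ; 1ℤ; -1ℤ)
import Data.Integer.Properties as ℤ
import Data.Integer.Divisibility.Signed as ℤ∣
open import Data.Integer.Tactic.RingSolver using (solve-∀)
open import Data.List using (List; []; _∷_; length)
open import Data.Maybe using (Maybe; just; nothing)
open import Data.Nat as ℕ using (ℕ; zero; suc; _≤_; _<_; _∸_; _%_; _≡ᵇ_; NonZero)
import Data.Nat.Properties as ℕ
open import Algebra.Properties.CommutativeSemigroup ℕ.+-commutativeSemigroup using () renaming (x∙yz≈y∙xz to x+[y+z]≡y+[x+z])
open import Data.Nat.DivMod using (m<n⇒m%n≡m; %-distribˡ-+; m%n%n≡m%n; [m+n]%n≡m%n)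
open import Data.Nat.Coprimality using (Coprime; coprime-Bézout)
import Data.Nat.GCD as GCD
open import Data.Nat.Primality using (Prime; prime⇒irreducible; prime⇒nonZero)
open import Data.Product using (Σ; ∃; _×_; _,_; proj₁; proj₂)
open import Data.Sum using (inj₁; inj₂)
open import Data.Unit using (tt)
open import Data.Vec.Functional using (Vector; init; last)
open import Function using (_∘_)
open import Relation.Binary.Definitions using (tri<; tri≈; tri>)
open import Relation.Binary.PropositionalEquality as ≡ using (_≡_; _≢_; _≗_)
open import Relation.Nullary using (¬_; yes; no)
open import Relation.Nullary.Negation using (contradiction)

module FinChain {a ℓ} {A : Set a} {m} (Q : Fin m → A → Set ℓ)
                (step : ∀ i j → toℕ j ≡ suc (toℕ i) → ∀ {x} → Q i x → Q j x) where

  chain-+ : ∀ d i j → toℕ j ≡ d ℕ.+ toℕ i → ∀ {x} → Q i x → Q j x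
  chain-+ zero i j j≡i = ≡.subst (λ k → Q k _) (Fin.toℕ-injective (≡.sym j≡i))
  chain-+ (suc d) i j j≡1+d+i Qix = step k j (≡.trans j≡1+d+i (≡.cong suc (≡.sym (Fin.toℕ-fromℕ< k<m))))
                                      (chain-+ d i k (Fin.toℕ-fromℕ< k<m) Qix)
    where
    k<m : d ℕ.+ toℕ i < _
    k<m = ℕ.<⇒≤ (≡.subst (_< _) j≡1+d+i (Fin.toℕ<n j))
    k = fromℕ< k<m

  chain-≤ : ∀ {i j} → toℕ i ≤ toℕ j → ∀ {x} → Q i x → Q j x
  chain-≤ {i} {j} i≤j with d , i+d≡j ← ℕ.m≤n⇒∃[o]m+o≡n i≤j =
    chain-+ d i j (≡.trans (≡.sym i+d≡j) (ℕ.+-comm (toℕ i) d))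

-- Congruences in commutative rings

ℤ-rawRing : RawRing 0ℓ 0ℓ
ℤ-rawRing = CommutativeRing.rawRing ℤ.+-*-commutativeRing

-- The parameter ℤ→R lets the ring solver normalise integer coefficients.
module ℤAlgebra (R : CommutativeRing 0ℓ 0ℓ)
                (ℤ→R : ℤ-rawRing -Raw-AlmostCommutative⟶ fromCommutativeRing R) where

  open CommutativeRing R public
  open import Algebra.Properties.Semiring.Exp semiring public using (_^_; ^-homo-*)
  open import Algebra.Definitions.RawMagma *-rawMagma public using (_∣_; _,_)
  open import Algebra.Properties.Semiring.Sum semiring public
    using (sum; sum-syntax; sum-remove; ∑-distrib-+; *-distribˡ-sum; sum-cong-≋)
  open import Relation.Binary.Reasoning.Setoid setoid
  open import Algebra.Properties.Ring ring using (-0#≈0#; -1*x≈-x)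

  private
    open _-Raw-AlmostCommutative⟶_ ℤ→R using () renaming (⟦_⟧ to ι)

    ι-≟ : ∀ a b → Maybe (ι a ≈ ι b)
    ι-≟ a b with a ℤ.≟ b
    ... | yes ≡.refl = just refl
    ... | no _ = nothing

  open import Algebra.Solver.Ring ℤ-rawRing (fromCommutativeRing R) ℤ→R ι-≟ public
    using (solve; _:=_; _:+_; _:*_; :-_; _:-_)

  infix 4 _≡_⟨mod_⟩ _∣_⟨mod_⟩

  record _≡_⟨mod_⟩ (x y M : Carrier) : Set where
    constructor witness
    field
      factor   : Carrier
      equation : x ≈ y + M * factor

  _∣_⟨mod_⟩ : Carrier → Carrier → Carrier → Set
  a ∣ x ⟨mod M ⟩ = ∃ λ s → x ≡ a * s ⟨mod M ⟩

  ≈⇒mod : ∀ {M x y} → x ≈ y → x ≡ y ⟨mod M ⟩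
  ≈⇒mod {M} {x} {y} x≈y = witness 0# (trans x≈y (sym (trans (+-congˡ (zeroʳ M)) (+-identityʳ y))))

  ∣-refl : ∀ {M a} → a ∣ a ⟨mod M ⟩
  ∣-refl {a = a} = 1# , ≈⇒mod (sym (*-identityʳ a))

  mod-refl : ∀ {M x} → x ≡ x ⟨mod M ⟩
  mod-refl = ≈⇒mod refl

  mod-sym : ∀ {M x y} → x ≡ y ⟨mod M ⟩ → y ≡ x ⟨mod M ⟩
  mod-sym {M} {x} {y} (witness w x≈y+Mw) = witness (- w) (begin
    y                  ≈⟨ solve 2 (λ y a → y := y :+ a :- a) refl y (M * w) ⟩
    y + M * w - M * w  ≈⟨ +-congʳ (sym x≈y+Mw) ⟩
    x - M * w          ≈⟨ solve 3 (λ x a w → x :- a :* w := x :+ a :* (:- w)) refl x M w ⟩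
    x + M * - w        ∎)

  mod-trans : ∀ {M x y z} → x ≡ y ⟨mod M ⟩ → y ≡ z ⟨mod M ⟩ → x ≡ z ⟨mod M ⟩
  mod-trans {M} {x} {y} {z} (witness v x≈y+Mv) (witness w y≈z+Mw) = witness (w + v) (begin
    x                  ≈⟨ x≈y+Mv ⟩
    y + M * v          ≈⟨ +-congʳ y≈z+Mw ⟩
    z + M * w + M * v  ≈⟨ solve 4 (λ z a w v → z :+ a :* w :+ a :* v := z :+ a :* (w :+ v)) refl z M w v ⟩
    z + M * (w + v)    ∎)

  mod-resp : ∀ {M x x′ y y′} → x ≈ x′ → y ≈ y′ → x ≡ y ⟨mod M ⟩ → x′ ≡ y′ ⟨mod M ⟩
  mod-resp x≈x′ y≈y′ x≡y = mod-trans (≈⇒mod (sym x≈x′)) (mod-trans x≡y (≈⇒mod y≈y′))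

  mod-+ : ∀ {M x x′ y y′} → x ≡ x′ ⟨mod M ⟩ → y ≡ y′ ⟨mod M ⟩ → x + y ≡ x′ + y′ ⟨mod M ⟩
  mod-+ {M} {x} {x′} {y} {y′} (witness v x≈) (witness w y≈) = witness (v + w) (begin
    x + y                      ≈⟨ +-cong x≈ y≈ ⟩
    x′ + M * v + (y′ + M * w)  ≈⟨ solve 5 (λ x y a v w → x :+ a :* v :+ (y :+ a :* w) := x :+ y :+ a :* (v :+ w)) refl x′ y′ M v w ⟩
    x′ + y′ + M * (v + w)      ∎)

  mod-neg : ∀ {M x x′} → x ≡ x′ ⟨mod M ⟩ → - x ≡ - x′ ⟨mod M ⟩
  mod-neg {M} {x} {x′} (witness w x≈) = witness (- w) (begin
    - x             ≈⟨ -‿cong x≈ ⟩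
    - (x′ + M * w)  ≈⟨ solve 3 (λ x a w → :- (x :+ a :* w) := :- x :+ a :* (:- w)) refl x′ M w ⟩
    - x′ + M * - w  ∎)

  mod-- : ∀ {M x x′ y y′} → x ≡ x′ ⟨mod M ⟩ → y ≡ y′ ⟨mod M ⟩ → x - y ≡ x′ - y′ ⟨mod M ⟩
  mod-- x≡x′ y≡y′ = mod-+ x≡x′ (mod-neg y≡y′)

  mod-*ˡ : ∀ {M x x′} c → x ≡ x′ ⟨mod M ⟩ → c * x ≡ c * x′ ⟨mod M ⟩
  mod-*ˡ {M} {x} {x′} c (witness w x≈) = witness (c * w) (begin
    c * x               ≈⟨ *-congˡ x≈ ⟩
    c * (x′ + M * w)    ≈⟨ solve 4 (λ c x a w → c :* (x :+ a :* w) := c :* x :+ a :* (c :* w)) refl c x′ M w ⟩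
    c * x′ + M * (c * w) ∎)

  mod-*ʳ : ∀ {M x x′} c → x ≡ x′ ⟨mod M ⟩ → x * c ≡ x′ * c ⟨mod M ⟩
  mod-*ʳ {x = x} {x′} c x≡x′ = mod-resp (*-comm c x) (*-comm c x′) (mod-*ˡ c x≡x′)

  mod-zero-+ : ∀ {M x y} → x ≡ 0# ⟨mod M ⟩ → y ≡ 0# ⟨mod M ⟩ → x + y ≡ 0# ⟨mod M ⟩
  mod-zero-+ x≡0 y≡0 = mod-trans (mod-+ x≡0 y≡0) (≈⇒mod (+-identityʳ 0#))

  mod-zero-neg : ∀ {M x} → x ≡ 0# ⟨mod M ⟩ → - x ≡ 0# ⟨mod M ⟩
  mod-zero-neg x≡0 = mod-trans (mod-neg x≡0) (≈⇒mod -0#≈0#)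

  mod-zero-*ˡ : ∀ {M x} c → x ≡ 0# ⟨mod M ⟩ → c * x ≡ 0# ⟨mod M ⟩
  mod-zero-*ˡ c x≡0 = mod-trans (mod-*ˡ c x≡0) (≈⇒mod (zeroʳ c))

  mod-zero-*ʳ : ∀ {M x} c → x ≡ 0# ⟨mod M ⟩ → x * c ≡ 0# ⟨mod M ⟩
  mod-zero-*ʳ c x≡0 = mod-trans (mod-*ʳ c x≡0) (≈⇒mod (zeroˡ c))

  mod-modulus-≈ : ∀ {M N x y} → M ≈ N → x ≡ y ⟨mod M ⟩ → x ≡ y ⟨mod N ⟩
  mod-modulus-≈ M≈N (witness w x≈) = witness w (trans x≈ (+-congˡ (*-congʳ M≈N)))

  ∣-modulus-≈ : ∀ {M N a x} → M ≈ N → a ∣ x ⟨mod M ⟩ → a ∣ x ⟨mod N ⟩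
  ∣-modulus-≈ M≈N (s , x≡as) = s , mod-modulus-≈ M≈N x≡as

  ∣-resp : ∀ {M a x y} → x ≈ y → a ∣ x ⟨mod M ⟩ → a ∣ y ⟨mod M ⟩
  ∣-resp x≈y (s , x≡as) = s , mod-resp x≈y refl x≡as

  0∣⇒≡0 : ∀ {M x} → 0# ∣ x ⟨mod M ⟩ → x ≡ 0# ⟨mod M ⟩
  0∣⇒≡0 (s , x≡0s) = mod-trans x≡0s (≈⇒mod (zeroˡ s))

  mod-1# : ∀ {x y} → x ≡ y ⟨mod 1# ⟩
  mod-1# {x} {y} = witness (x - y) (begin
    x                 ≈⟨ solve 2 (λ x y → x := y :+ (x :- y)) refl x y ⟩
    y + (x - y)       ≈⟨ +-congˡ (*-identityˡ (x - y)) ⟨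
    y + 1# * (x - y)  ∎)

  mod-∣ : ∀ {M N x y} → M ∣ N → x ≡ y ⟨mod N ⟩ → x ≡ y ⟨mod M ⟩
  mod-∣ {M} {N} {x} {y} (q , qM≈N) (witness w x≈) = witness (q * w) (begin
    x              ≈⟨ x≈ ⟩
    y + N * w      ≈⟨ +-congˡ (*-congʳ qM≈N) ⟨
    y + q * M * w  ≈⟨ solve 4 (λ y q a w → y :+ q :* a :* w := y :+ a :* (q :* w)) refl y q M w ⟩
    y + M * (q * w) ∎)

  mod-*-modulus : ∀ {M x y} a → x ≡ y ⟨mod M ⟩ → a * x ≡ a * y ⟨mod a * M ⟩
  mod-*-modulus {M} {x} {y} a (witness w x≈) = witness w (begin
    a * x                ≈⟨ *-congˡ x≈ ⟩
    a * (y + M * w)      ≈⟨ solve 4 (λ a b y w → a :* (y :+ b :* w) := a :* y :+ a :* b :* w) refl a M y w ⟩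
    a * y + a * M * w    ∎)

  modulus-*≡0 : ∀ M x → M * x ≡ 0# ⟨mod M ⟩
  modulus-*≡0 M x = witness x (sym (+-identityˡ _))

  ^-mono-∣ : ∀ P {e f} → e ≤ f → P ^ e ∣ P ^ f
  ^-mono-∣ P {e} e≤f with d , ≡.refl ← ℕ.m≤n⇒∃[o]m+o≡n e≤f =
    P ^ d , trans (*-comm (P ^ d) (P ^ e)) (sym (^-homo-* P e d))

  ∑-closed : ∀ {p} (Q : Carrier → Set p) → Q 0# → (∀ {x y} → Q x → Q y → Q (x + y)) →
             ∀ {n} (f : Fin n → Carrier) → (∀ i → Q (f i)) → Q (sum f)
  ∑-closed Q Q0 Q+ {zero} f Qf = Q0
  ∑-closed Q Q0 Q+ {suc n} f Qf = Q+ (Qf Fin.zero) (∑-closed Q Q0 Q+ (f ∘ Fin.suc) (Qf ∘ Fin.suc))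

  ∑-zero-mod : ∀ {M n} {f : Fin n → Carrier} → (∀ i → f i ≡ 0# ⟨mod M ⟩) → sum f ≡ 0# ⟨mod M ⟩
  ∑-zero-mod = ∑-closed (_≡ 0# ⟨mod _ ⟩) mod-refl mod-zero-+ _

  ∑-single-mod : ∀ {M n} {f : Fin n → Carrier} j → (∀ i → i ≢ j → f i ≡ 0# ⟨mod M ⟩) →
                 sum f ≡ f j ⟨mod M ⟩
  ∑-single-mod {n = suc n} {f} j others≡0 =
    mod-resp (sym (sum-remove f)) (+-identityʳ (f j))
      (mod-+ mod-refl (∑-zero-mod (λ i → others≡0 (Fin.punchIn j i) (Fin.punchInᵢ≢i j i))))

  Regular : Carrier → Set
  Regular a = ∀ x → a * x ≈ 0# → x ≈ 0#

  Regular-* : ∀ {a b} → Regular a → Regular b → Regular (a * b)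
  Regular-* {a} {b} reg-a reg-b x abx≈0 = reg-b x (reg-a (b * x) (trans (sym (*-assoc a b x)) abx≈0))

  Regular-^ : ∀ {a} → Regular a → ∀ d → Regular (a ^ d)
  Regular-^ reg-a zero x 1x≈0 = trans (sym (*-identityˡ x)) 1x≈0
  Regular-^ reg-a (suc d) = Regular-* reg-a (Regular-^ reg-a d)

  mod-cancel : ∀ {a M x y} → Regular a → a * x ≡ a * y ⟨mod a * M ⟩ → x ≡ y ⟨mod M ⟩
  mod-cancel {a} {M} {x} {y} reg-a (witness w ax≈) = witness w (begin
    x          ≈⟨ solve 2 (λ x z → x := x :- z :+ z) refl x z ⟩
    x - z + z  ≈⟨ +-congʳ (reg-a _ a[x-z]≈0) ⟩
    0# + z     ≈⟨ +-identityˡ z ⟩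
    z          ∎)
    where
    z = y + M * w
    a[x-z]≈0 : a * (x - z) ≈ 0#
    a[x-z]≈0 = begin
      a * (x - z)
        ≈⟨ solve 5 (λ a x y b w → a :* (x :- (y :+ b :* w)) := a :* x :- (a :* y :+ a :* b :* w)) refl a x y M w ⟩
      a * x - (a * y + a * M * w)
        ≈⟨ +-congʳ ax≈ ⟩
      a * y + a * M * w - (a * y + a * M * w)
        ≈⟨ -‿inverseʳ _ ⟩
      0#
        ∎

  -- Hensel step for inverses: if u ν = 1 + Pᵉ w, then (u − Pᵉ w u₁) ν ≡ 1 modulo Pᵉ⁺¹.
  unit-lift : ∀ {P ν e} → (∃ λ u₁ → u₁ * ν ≡ 1# ⟨mod P ⟩) → (∃ λ u → u * ν ≡ 1# ⟨mod P ^ e ⟩) →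
              ∃ λ u → u * ν ≡ 1# ⟨mod P ^ suc e ⟩
  unit-lift {P} {ν} {e} (u₁ , witness ε u₁ν≈) (u , witness w uν≈) =
    u - Q * w * u₁ , witness (- (w * ε)) (begin
      (u - Q * w * u₁) * ν
        ≈⟨ solve 5 (λ u a w v n → (u :- a :* w :* v) :* n := u :* n :- a :* w :* (v :* n)) refl u Q w u₁ ν ⟩
      u * ν - Q * w * (u₁ * ν)
        ≈⟨ +-cong uν≈ (-‿cong Qw[u₁ν]≈) ⟩
      1# + Q * w - (Q * w + P * Q * (w * ε))
        ≈⟨ solve 5 (λ o a w P ε → o :+ a :* w :- (a :* w :+ P :* a :* (w :* ε)) := o :+ P :* a :* (:- (w :* ε))) refl 1# Q w P ε ⟩
      1# + P * Q * - (w * ε)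
        ∎)
    where
    Q = P ^ e
    Qw[u₁ν]≈ : Q * w * (u₁ * ν) ≈ Q * w + P * Q * (w * ε)
    Qw[u₁ν]≈ = begin
      Q * w * (u₁ * ν)
        ≈⟨ *-congˡ u₁ν≈ ⟩
      Q * w * (1# + P * ε)
        ≈⟨ distribˡ (Q * w) 1# (P * ε) ⟩
      Q * w * 1# + Q * w * (P * ε)
        ≈⟨ +-cong (*-identityʳ (Q * w)) (solve 4 (λ a w P ε → a :* w :* (P :* ε) := P :* a :* (w :* ε)) refl Q w P ε) ⟩
      Q * w + P * Q * (w * ε)
        ∎

  module CoprimeFactors (P ν : Carrier) (P-regular : Regular P)
                        (ν-unit-mod-P : ∃ λ u → u * ν ≡ 1# ⟨mod P ⟩) where

    record Bezout (X Y : Carrier) : Set where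
      constructor bezout
      field
        α β      : Carrier
        identity : α * X + β * Y ≡ ν ⟨mod P ⟩

    ν-expansion : ∀ {X Y} (b : Bezout X Y) → let open Bezout b in
                  ∃ λ ε → ν ≈ α * X + β * Y - P * ε
    ν-expansion (bezout α β (witness ε eq)) =
      ε , trans (solve 2 (λ n q → n := n :+ q :- q) refl ν (P * ε)) (+-congʳ (sym eq))

    ν-unit : ∀ e → ∃ λ u → u * ν ≡ 1# ⟨mod P ^ e ⟩
    ν-unit zero = 0# , mod-1#
    ν-unit (suc e) = unit-lift {e = e} ν-unit-mod-P (ν-unit e)

    ν-divides : ∀ e {X y t} → ν * y ≡ X * t ⟨mod P ^ e ⟩ → X ∣ y ⟨mod P ^ e ⟩
    ν-divides e {X} {y} {t} νy≡Xt = divide (ν-unit e)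
      where
      divide : (∃ λ u → u * ν ≡ 1# ⟨mod P ^ e ⟩) → X ∣ y ⟨mod P ^ e ⟩
      divide (u , uν≡1) =
        u * t , mod-trans (mod-resp (*-identityˡ y) (*-assoc u ν y) (mod-*ʳ y (mod-sym uν≡1)))
                  (mod-trans (mod-*ˡ u νy≡Xt) (≈⇒mod (solve 3 (λ u X t → u :* (X :* t) := X :* (u :* t)) refl u X t)))

    ν-cancel : ∀ e {z} → ν * z ≡ 0# ⟨mod P ^ e ⟩ → z ≡ 0# ⟨mod P ^ e ⟩
    ν-cancel e νz≡0 = 0∣⇒≡0 (ν-divides e (mod-trans νz≡0 (≈⇒mod (sym (zeroˡ 0#)))))

    annihilator : ∀ {X Y} → Bezout X Y → ∀ e {y} → Y * y ≡ 0# ⟨mod P ^ e ⟩ → X ∣ y ⟨mod P ^ e ⟩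
    annihilator _ zero _ = 0# , mod-1#
    annihilator {X} {Y} b (suc e) {y} Yy≡0 = ν-divides (suc e) νy≡X[αy-Ps]
      where
      open Bezout b
      ε = proj₁ (ν-expansion b)
      Y[εy]≡0 : Y * (ε * y) ≡ 0# ⟨mod P ^ e ⟩
      Y[εy]≡0 = mod-resp (solve 3 (λ ε Y y → ε :* (Y :* y) := Y :* (ε :* y)) refl ε Y y) refl
                  (mod-zero-*ˡ ε (mod-∣ (^-mono-∣ P (ℕ.n≤1+n e)) Yy≡0))
      s = proj₁ (annihilator b e Y[εy]≡0)
      νy≈ : ν * y ≈ X * (α * y) + β * (Y * y) - P * (ε * y)
      νy≈ = trans (*-congʳ (proj₂ (ν-expansion b)))
              (solve 7 (λ α X β Y P ε y → (α :* X :+ β :* Y :- P :* ε) :* y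
                         := X :* (α :* y) :+ β :* (Y :* y) :- P :* (ε :* y)) refl α X β Y P ε y)
      νy≡X[αy-Ps] : ν * y ≡ X * (α * y - P * s) ⟨mod P ^ suc e ⟩
      νy≡X[αy-Ps] = mod-resp (sym νy≈)
        (trans (+-congʳ (+-identityʳ _)) (solve 5 (λ X α y P s → X :* (α :* y) :- P :* (X :* s) := X :* (α :* y :- P :* s)) refl X α y P s))
        (mod-- (mod-+ mod-refl (mod-zero-*ˡ β Yy≡0)) (mod-*-modulus P (proj₂ (annihilator b e Y[εy]≡0))))

    cofactor-annihilates : ∀ {A B X Y} M → Bezout A B → A * B ≡ 0# ⟨mod P ^ M ⟩ →
                           X * Y ≡ 0# ⟨mod P ^ M ⟩ → X ∣ A ⟨mod P ⟩ → Y * A ≡ 0# ⟨mod P ^ M ⟩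
    cofactor-annihilates {A} {B} {X} {Y} M b AB≡0 XY≡0 (v , witness w A≈Xv+Pw) = YA≡0 M ℕ.≤-refl
      where
      open Bezout b
      ε = proj₁ (ν-expansion b)
      ν[YA]≈ : ν * (Y * A) ≈ α * (A * v) * (X * Y) + α * w * (P * (Y * A)) + β * Y * (A * B) - ε * (P * (Y * A))
      ν[YA]≈ = begin
        ν * (Y * A)
          ≈⟨ *-congʳ (proj₂ (ν-expansion b)) ⟩
        (α * A + β * B - P * ε) * (Y * A)
          ≈⟨ solve 7 (λ α A β B P ε Y → (α :* A :+ β :* B :- P :* ε) :* (Y :* A)
                       := α :* (Y :* A) :* A :+ β :* Y :* (A :* B) :- ε :* (P :* (Y :* A))) refl α A β B P ε Y ⟩
        α * (Y * A) * A + β * Y * (A * B) - ε * (P * (Y * A))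
          ≈⟨ +-congʳ (+-congʳ (*-congˡ A≈Xv+Pw)) ⟩
        α * (Y * A) * (X * v + P * w) + β * Y * (A * B) - ε * (P * (Y * A))
          ≈⟨ +-congʳ (+-congʳ (solve 7 (λ α Y A X v P w → α :* (Y :* A) :* (X :* v :+ P :* w)
                                         := α :* (A :* v) :* (X :* Y) :+ α :* w :* (P :* (Y :* A))) refl α Y A X v P w)) ⟩
        α * (A * v) * (X * Y) + α * w * (P * (Y * A)) + β * Y * (A * B) - ε * (P * (Y * A))
          ∎
      YA≡0 : ∀ e → e ≤ M → Y * A ≡ 0# ⟨mod P ^ e ⟩
      YA≡0 zero _ = mod-1#
      YA≡0 (suc e) e<M = ν-cancel (suc e) (mod-resp (sym ν[YA]≈) refl
        (mod-zero-+ (mod-zero-+ (mod-zero-+ (mod-zero-*ˡ _ (weaken XY≡0)) (mod-zero-*ˡ _ P[YA]≡0))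
                                (mod-zero-*ˡ _ (weaken AB≡0)))
                    (mod-zero-neg (mod-zero-*ˡ _ P[YA]≡0))))
        where
        weaken : ∀ {x} → x ≡ 0# ⟨mod P ^ M ⟩ → x ≡ 0# ⟨mod P ^ suc e ⟩
        weaken = mod-∣ (^-mono-∣ P e<M)
        P[YA]≡0 : P * (Y * A) ≡ 0# ⟨mod P ^ suc e ⟩
        P[YA]≡0 = mod-resp refl (zeroʳ P) (mod-*-modulus P (YA≡0 e (ℕ.<⇒≤ e<M)))

    -- G j and H j stand for the Hensel lifts of the generators of 𝒞ⱼ and 𝒟ⱼ, K j and L j for their
    -- cofactors in Xⁿ − 1; G⊆H and H⊆G encode 𝒞ᵢ ⊆ 𝒟ᵢ ⊆ 𝒞ᵢ₊₁, and LiftIdeal is the lifted code.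
    module LiftedChain
      (m : ℕ) (G H K L : Fin m → Carrier)
      (HK≡0 : ∀ j → H j * K j ≡ 0# ⟨mod P ^ m ⟩) (GL≡0 : ∀ j → G j * L j ≡ 0# ⟨mod P ^ m ⟩)
      (H⊥K : ∀ j → Bezout (H j) (K j)) (G⊥L : ∀ j → Bezout (G j) (L j))
      (G⊆H : ∀ i {x} → G i ∣ x ⟨mod P ⟩ → H i ∣ x ⟨mod P ⟩)
      (H⊆G : ∀ i j → toℕ j ≡ suc (toℕ i) → ∀ {x} → H i ∣ x ⟨mod P ⟩ → G j ∣ x ⟨mod P ⟩)
      where

      G-mono : ∀ {i j} → toℕ i ≤ toℕ j → ∀ {x} → G i ∣ x ⟨mod P ⟩ → G j ∣ x ⟨mod P ⟩
      G-mono = FinChain.chain-≤ (λ j x → G j ∣ x ⟨mod P ⟩) (λ i j j≡1+i → H⊆G i j j≡1+i ∘ G⊆H i)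

      H⊆G-< : ∀ {i j} → toℕ i < toℕ j → ∀ {x} → H i ∣ x ⟨mod P ⟩ → G j ∣ x ⟨mod P ⟩
      H⊆G-< {i} {j} i<j = G-mono (ℕ.≤-trans (ℕ.≤-reflexive (Fin.toℕ-fromℕ< 1+i<m)) i<j)
                          ∘ H⊆G i (fromℕ< 1+i<m) (Fin.toℕ-fromℕ< 1+i<m)
        where 1+i<m = ℕ.≤-<-trans i<j (Fin.toℕ<n j)

      KG≡0 : ∀ j → K j * G j ≡ 0# ⟨mod P ^ m ⟩
      KG≡0 j = cofactor-annihilates m (G⊥L j) (GL≡0 j) (HK≡0 j) (G⊆H j ∣-refl)

      KH≡0 : ∀ i j → toℕ j ≡ suc (toℕ i) → K j * H i ≡ 0# ⟨mod P ^ m ⟩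
      KH≡0 i j j≡1+i = cofactor-annihilates m (H⊥K i) (HK≡0 i) (HK≡0 j) (G⊆H j (H⊆G i j j≡1+i ∣-refl))

      LG≡0 : ∀ {i j} → toℕ i ≤ toℕ j → L j * G i ≡ 0# ⟨mod P ^ m ⟩
      LG≡0 {i} i≤j = cofactor-annihilates m (G⊥L i) (GL≡0 i) (GL≡0 _) (G-mono i≤j ∣-refl)

      LH≡0 : ∀ {i j} → toℕ i < toℕ j → L j * H i ≡ 0# ⟨mod P ^ m ⟩
      LH≡0 {i} i<j = cofactor-annihilates m (H⊥K i) (HK≡0 i) (GL≡0 _) (H⊆G-< i<j ∣-refl)

      lift : (Fin m → Carrier) → (Fin m → Carrier) → Carrier
      lift F u = ∑[ j < m ] (P ^ toℕ j * (F j * u j))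

      LiftIdeal : Carrier → Set
      LiftIdeal x = ∃ λ u → x ≡ lift G u ⟨mod P ^ m ⟩

      LiftIdeal-resp : ∀ {x y} → x ≡ y ⟨mod P ^ m ⟩ → LiftIdeal y → LiftIdeal x
      LiftIdeal-resp x≡y (u , y≡Gu) = u , mod-trans x≡y y≡Gu

      lift-cong : ∀ F {u u′} → (∀ j → u j ≈ u′ j) → lift F u ≈ lift F u′
      lift-cong F u≈u′ = sum-cong-≋ (λ j → *-congˡ (*-congˡ (u≈u′ j)))

      lift-+ : ∀ F u u′ → lift F (λ j → u j + u′ j) ≈ lift F u + lift F u′
      lift-+ F u u′ = trans (sum-cong-≋ (λ j → solve 4 (λ a f x y → a :* (f :* (x :+ y))
                                          := a :* (f :* x) :+ a :* (f :* y)) refl (P ^ toℕ j) (F j) (u j) (u′ j)))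
                             (∑-distrib-+ (λ j → P ^ toℕ j * (F j * u j)) (λ j → P ^ toℕ j * (F j * u′ j)))

      lift-*ˡ : ∀ F r u → lift F (λ j → r * u j) ≈ r * lift F u
      lift-*ˡ F r u = trans (sum-cong-≋ (λ j → solve 4 (λ a f r x → a :* (f :* (r :* x))
                                          := r :* (a :* (f :* x))) refl (P ^ toℕ j) (F j) r (u j)))
                             (sym (*-distribˡ-sum r (λ j → P ^ toℕ j * (F j * u j))))

      lift-- : ∀ F u u′ → lift F (λ j → u j - u′ j) ≈ lift F u - lift F u′
      lift-- F u u′ = begin
        lift F (λ j → u j - u′ j)            ≈⟨ lift-+ F u (λ j → - u′ j) ⟩
        lift F u + lift F (λ j → - u′ j)     ≈⟨ +-congˡ (lift-cong F (λ j → sym (-1*x≈-x (u′ j)))) ⟩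
        lift F u + lift F (λ j → - 1# * u′ j) ≈⟨ +-congˡ (lift-*ˡ F (- 1#) u′) ⟩
        lift F u + - 1# * lift F u′          ≈⟨ +-congˡ (-1*x≈-x _) ⟩
        lift F u - lift F u′                 ∎

      LiftIdeal-0 : LiftIdeal 0#
      LiftIdeal-0 = (λ _ → 0#) , ≈⇒mod (sym (trans (lift-cong G (λ _ → sym (zeroˡ 0#))) (trans (lift-*ˡ G 0# (λ _ → 0#)) (zeroˡ _))))

      LiftIdeal-+ : ∀ {x y} → LiftIdeal x → LiftIdeal y → LiftIdeal (x + y)
      LiftIdeal-+ (u , x≡Gu) (u′ , y≡Gu′) =
        (λ j → u j + u′ j) , mod-trans (mod-+ x≡Gu y≡Gu′) (≈⇒mod (sym (lift-+ G u u′)))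

      LiftIdeal-single : ∀ j v → LiftIdeal (P ^ toℕ j * (G j * v))
      LiftIdeal-single j v = u , mod-sym (mod-trans (∑-single-mod j others≡0) (≈⇒mod (*-congˡ (*-congˡ u-j≈v))))
        where
        u : Fin m → Carrier
        u i with i Fin.≟ j
        ... | yes _ = v
        ... | no  _ = 0#
        u-j≈v : u j ≈ v
        u-j≈v with j Fin.≟ j
        ... | yes _ = refl
        ... | no j≢j = contradiction ≡.refl j≢j
        others≡0 : ∀ i → i ≢ j → P ^ toℕ i * (G i * u i) ≡ 0# ⟨mod P ^ m ⟩
        others≡0 i i≢j with i Fin.≟ j
        ... | yes i≡j = contradiction i≡j i≢j
        ... | no  _ = ≈⇒mod (trans (*-congˡ (zeroʳ (G i))) (zeroʳ _))

      mod-P^-+ : ∀ a b {x y} → x ≡ y ⟨mod P ^ a * P ^ b ⟩ → x ≡ y ⟨mod P ^ (a ℕ.+ b) ⟩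
      mod-P^-+ a b = mod-modulus-≈ (sym (^-homo-* P a b))

      record Decomposition (j : Fin m) (d : ℕ) (y : Carrier) : Set where
        field
          v r     : Carrier
          y≈Gv+Pr : y ≈ G j * v + P * r
          Kr≡0    : K j * r ≡ 0# ⟨mod P ^ d ⟩

      decompose : ∀ {j d y} → suc d ≤ m → G j ∣ y ⟨mod P ⟩ → K j * y ≡ 0# ⟨mod P ^ suc d ⟩ → Decomposition j d y
      decompose {j} {d} {y} 1+d≤m (v , witness r y≈Gv+Pr) Ky≡0 =
        record { v = v ; r = r ; y≈Gv+Pr = y≈Gv+Pr
               ; Kr≡0 = mod-cancel P-regular (mod-resp (sym P[Kr]≈) (sym (zeroʳ P)) Ky-KGv≡0) }
        where
        P[Kr]≈ : P * (K j * r) ≈ K j * y - K j * G j * v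
        P[Kr]≈ = begin
          P * (K j * r)
            ≈⟨ solve 5 (λ P k r g v → P :* (k :* r) := k :* (g :* v :+ P :* r) :- k :* g :* v) refl P (K j) r (G j) v ⟩
          K j * (G j * v + P * r) - K j * G j * v
            ≈⟨ +-congʳ (*-congˡ (sym y≈Gv+Pr)) ⟩
          K j * y - K j * G j * v
            ∎
        Ky-KGv≡0 : K j * y - K j * G j * v ≡ 0# ⟨mod P ^ suc d ⟩
        Ky-KGv≡0 = mod-zero-+ Ky≡0 (mod-zero-neg (mod-zero-*ʳ v (mod-∣ (^-mono-∣ P 1+d≤m) (KG≡0 j))))

      P^j-split : ∀ j {d y} (dec : Decomposition j d y) → let open Decomposition dec in
                  P ^ toℕ j * y ≈ P ^ toℕ j * (G j * v) + P ^ suc (toℕ j) * r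
      P^j-split j dec = trans (*-congˡ y≈Gv+Pr)
        (solve 5 (λ a g v P r → a :* (g :* v :+ P :* r) := a :* (g :* v) :+ P :* a :* r) refl (P ^ toℕ j) (G j) v P r)
        where open Decomposition dec

      -- Induction on d = m − j: split y ≡ Gⱼ v + P r, where r ≡ Hⱼ s modulo Pᵈ⁻¹ by the annihilator
      -- lemma, and treat Pʲ⁺¹ Hⱼ s at level j + 1, where Hⱼ s ∈ (Gⱼ₊₁) modulo P.
      ScaledMembership : ℕ → Set
      ScaledMembership d = ∀ j → toℕ j ℕ.+ d ≡ m → ∀ {y} → G j ∣ y ⟨mod P ⟩ →
                           K j * y ≡ 0# ⟨mod P ^ d ⟩ → LiftIdeal (P ^ toℕ j * y)

      scaledMembership-1 : ScaledMembership 1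
      scaledMembership-1 j j+1≡m G∣y Ky≡0 = LiftIdeal-resp
        (mod-trans (≈⇒mod (P^j-split j dec)) (mod-resp refl (+-identityʳ _) (mod-+ mod-refl P^[1+j]r≡0)))
        (LiftIdeal-single j v)
        where
        dec = decompose (≡.subst (1 ≤_) j+1≡m (ℕ.m≤n+m 1 (toℕ j))) G∣y Ky≡0
        open Decomposition dec
        P^[1+j]r≡0 : P ^ suc (toℕ j) * r ≡ 0# ⟨mod P ^ m ⟩
        P^[1+j]r≡0 = ≡.subst (λ e → P ^ suc (toℕ j) * r ≡ 0# ⟨mod P ^ e ⟩)
                       (≡.trans (ℕ.+-comm 1 (toℕ j)) j+1≡m) (modulus-*≡0 _ r)

      scaledMembership-step : ∀ d → ScaledMembership (suc d) → ScaledMembership (suc (suc d))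
      scaledMembership-step d IH j j+2+d≡m G∣y Ky≡0 = LiftIdeal-resp
        (mod-trans (≈⇒mod (P^j-split j dec)) (mod-+ mod-refl P^[1+j]r≡P^[1+j]Hs))
        (LiftIdeal-+ (LiftIdeal-single j v) next)
        where
        2+d≤m : suc (suc d) ≤ m
        2+d≤m = ≡.subst (suc (suc d) ≤_) j+2+d≡m (ℕ.m≤n+m (suc (suc d)) (toℕ j))
        dec = decompose 2+d≤m G∣y Ky≡0
        open Decomposition dec
        1+j<m : suc (toℕ j) < m
        1+j<m = ≡.subst (suc (toℕ j) <_) j+2+d≡m
                  (≡.subst (_≤ toℕ j ℕ.+ suc (suc d)) (ℕ.+-comm (toℕ j) 2) (ℕ.+-monoʳ-≤ (toℕ j) (ℕ.s≤s (ℕ.s≤s ℕ.z≤n))))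
        j′ = fromℕ< 1+j<m
        j′≡1+j : toℕ j′ ≡ suc (toℕ j)
        j′≡1+j = Fin.toℕ-fromℕ< 1+j<m
        j′+1+d≡m : toℕ j′ ℕ.+ suc d ≡ m
        j′+1+d≡m = ≡.trans (≡.cong (ℕ._+ suc d) j′≡1+j) (≡.trans (≡.sym (ℕ.+-suc (toℕ j) (suc d))) j+2+d≡m)
        r≡Hs = proj₂ (annihilator (H⊥K j) (suc d) Kr≡0)
        s = proj₁ (annihilator (H⊥K j) (suc d) Kr≡0)
        P^[1+j]r≡P^[1+j]Hs : P ^ suc (toℕ j) * r ≡ P ^ suc (toℕ j) * (H j * s) ⟨mod P ^ m ⟩
        P^[1+j]r≡P^[1+j]Hs = ≡.subst (λ e → P ^ suc (toℕ j) * r ≡ P ^ suc (toℕ j) * (H j * s) ⟨mod P ^ e ⟩)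
          (≡.trans (≡.sym (ℕ.+-suc (toℕ j) (suc d))) j+2+d≡m)
          (mod-P^-+ (suc (toℕ j)) (suc d) (mod-*-modulus (P ^ suc (toℕ j)) r≡Hs))
        next : LiftIdeal (P ^ suc (toℕ j) * (H j * s))
        next = ≡.subst (λ e → LiftIdeal (P ^ e * (H j * s))) j′≡1+j
          (IH j′ j′+1+d≡m (H⊆G j j′ j′≡1+j (s , mod-refl))
            (mod-resp (*-assoc _ _ _) refl
              (mod-zero-*ʳ s (mod-∣ (^-mono-∣ P (ℕ.≤-trans (ℕ.n≤1+n _) 2+d≤m)) (KH≡0 j j′ j′≡1+j)))))

      scaledMembership : ∀ d → ScaledMembership d
      scaledMembership zero j j+0≡m _ _ =
        contradiction (≡.trans (≡.sym (ℕ.+-identityʳ (toℕ j))) j+0≡m) (ℕ.<⇒≢ (Fin.toℕ<n j))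
      scaledMembership (suc zero) = scaledMembership-1
      scaledMembership (suc (suc d)) = scaledMembership-step d (scaledMembership (suc d))

      G∣Hc⇒lift-H∈LiftIdeal : ∀ c → (∀ j → G j ∣ H j * c j ⟨mod P ⟩) → LiftIdeal (lift H c)
      G∣Hc⇒lift-H∈LiftIdeal c G∣Hc = ∑-closed LiftIdeal LiftIdeal-0 LiftIdeal-+ _ (λ j →
        scaledMembership (m ∸ toℕ j) j (ℕ.m+[n∸m]≡n (ℕ.<⇒≤ (Fin.toℕ<n j))) (G∣Hc j)
          (mod-∣ (^-mono-∣ P (ℕ.m∸n≤m m (toℕ j)))
            (mod-resp (solve 3 (λ h k c → h :* k :* c := k :* (h :* c)) refl (H j) (K j) (c j)) refl
              (mod-zero-*ʳ (c j) (HK≡0 j)))))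

      -- Multiplying by L j kills every summand of index ≠ j modulo Pʲ⁺¹: those below j by LH≡0 and
      -- LG≡0, those above by their power of P.
      private
        L*lift : ∀ F u j → L j * lift F u ≈ ∑[ i < m ] (P ^ toℕ i * (L j * F i * u i))
        L*lift F u j = trans (*-distribˡ-sum (L j) (λ i → P ^ toℕ i * (F i * u i))) (sum-cong-≋ (λ i →
          solve 4 (λ l a f x → l :* (a :* (f :* x)) := a :* (l :* f :* x)) refl (L j) (P ^ toℕ i) (F i) (u i)))

        high-term≡0 : ∀ {e} (i : Fin m) x → e ≤ toℕ i → P ^ toℕ i * x ≡ 0# ⟨mod P ^ e ⟩
        high-term≡0 i x e≤i = mod-∣ (^-mono-∣ P e≤i) (modulus-*≡0 _ x)

        L*lift-H : ∀ c j → L j * lift H c ≡ P ^ toℕ j * (L j * H j * c j) ⟨mod P ^ suc (toℕ j) ⟩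
        L*lift-H c j = mod-trans (≈⇒mod (L*lift H c j)) (∑-single-mod j others≡0)
          where
          others≡0 : ∀ i → i ≢ j → P ^ toℕ i * (L j * H i * c i) ≡ 0# ⟨mod P ^ suc (toℕ j) ⟩
          others≡0 i i≢j with ℕ.<-cmp (toℕ i) (toℕ j)
          ... | tri< i<j _ _ = mod-zero-*ˡ _ (mod-zero-*ʳ (c i) (mod-∣ (^-mono-∣ P (Fin.toℕ<n j)) (LH≡0 i<j)))
          ... | tri≈ _ i≡j _ = contradiction (Fin.toℕ-injective i≡j) i≢j
          ... | tri> _ _ j<i = high-term≡0 i (L j * H i * c i) j<i

        L*lift-G : ∀ u j → L j * lift G u ≡ 0# ⟨mod P ^ suc (toℕ j) ⟩
        L*lift-G u j = mod-trans (≈⇒mod (L*lift G u j)) (∑-zero-mod terms≡0)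
          where
          terms≡0 : ∀ i → P ^ toℕ i * (L j * G i * u i) ≡ 0# ⟨mod P ^ suc (toℕ j) ⟩
          terms≡0 i with ℕ.≤-<-connex (toℕ i) (toℕ j)
          ... | inj₁ i≤j = mod-zero-*ˡ _ (mod-zero-*ʳ (u i) (mod-∣ (^-mono-∣ P (Fin.toℕ<n j)) (LG≡0 i≤j)))
          ... | inj₂ j<i = high-term≡0 i (L j * G i * u i) j<i

      lift-H∈LiftIdeal⇒G∣Hc : ∀ c → LiftIdeal (lift H c) → ∀ j → G j ∣ H j * c j ⟨mod P ⟩
      lift-H∈LiftIdeal⇒G∣Hc c (u , Hc≡Gu) j =
        ∣-modulus-≈ (*-identityʳ P) (annihilator (G⊥L j) 1 (mod-modulus-≈ (sym (*-identityʳ P)) L[Hc]≡0))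
        where
        P^j[LHc]≡0 : P ^ toℕ j * (L j * H j * c j) ≡ P ^ toℕ j * 0# ⟨mod P ^ toℕ j * P ⟩
        P^j[LHc]≡0 = mod-modulus-≈ (*-comm P _) (mod-resp refl (sym (zeroʳ _))
          (mod-trans (mod-sym (L*lift-H c j))
            (mod-trans (mod-*ˡ (L j) (mod-∣ (^-mono-∣ P (Fin.toℕ<n j)) Hc≡Gu)) (L*lift-G u j))))
        L[Hc]≡0 : L j * (H j * c j) ≡ 0# ⟨mod P ⟩
        L[Hc]≡0 = mod-resp (*-assoc _ _ _) refl (mod-cancel (Regular-^ P-regular (toℕ j)) P^j[LHc]≡0)

      module _ {x y c c′} (x≡Hc : x ≡ lift H c ⟨mod P ^ m ⟩) (y≡Hc′ : y ≡ lift H c′ ⟨mod P ^ m ⟩) where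

        private
          x-y≡H[c-c′] : x - y ≡ lift H (λ j → c j - c′ j) ⟨mod P ^ m ⟩
          x-y≡H[c-c′] = mod-trans (mod-- x≡Hc y≡Hc′) (≈⇒mod (sym (lift-- H c c′)))

          H[c-c′]≈ : ∀ j → H j * (c j - c′ j) ≈ H j * c j - H j * c′ j
          H[c-c′]≈ j = solve 3 (λ h x y → h :* (x :- y) := h :* x :- h :* y) refl (H j) (c j) (c′ j)

        difference-∈LiftIdeal⇒G∣ : LiftIdeal (x - y) → ∀ j → G j ∣ H j * c j - H j * c′ j ⟨mod P ⟩
        difference-∈LiftIdeal⇒G∣ x-y∈ j =
          ∣-resp (H[c-c′]≈ j) (lift-H∈LiftIdeal⇒G∣Hc _ (LiftIdeal-resp (mod-sym x-y≡H[c-c′]) x-y∈) j)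

        G∣⇒difference-∈LiftIdeal : (∀ j → G j ∣ H j * c j - H j * c′ j ⟨mod P ⟩) → LiftIdeal (x - y)
        G∣⇒difference-∈LiftIdeal G∣ =
          LiftIdeal-resp x-y≡H[c-c′] (G∣Hc⇒lift-H∈LiftIdeal _ (λ j → ∣-resp (sym (H[c-c′]≈ j)) (G∣ j)))

      witness-independent : ∀ {x c c′} → x ≡ lift H c ⟨mod P ^ m ⟩ → x ≡ lift H c′ ⟨mod P ^ m ⟩ →
                            ∀ j → G j ∣ H j * c j - H j * c′ j ⟨mod P ⟩
      witness-independent x≡Hc x≡Hc′ = difference-∈LiftIdeal⇒G∣ x≡Hc x≡Hc′
        (LiftIdeal-resp (≈⇒mod (-‿inverseʳ _)) LiftIdeal-0)

      witness-+ : ∀ {x y c c′ c″} → x ≡ lift H c ⟨mod P ^ m ⟩ → y ≡ lift H c′ ⟨mod P ^ m ⟩ →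
                  x + y ≡ lift H c″ ⟨mod P ^ m ⟩ → ∀ j → G j ∣ H j * c″ j - (H j * c j + H j * c′ j) ⟨mod P ⟩
      witness-+ {c = c} {c′} x≡Hc y≡Hc′ x+y≡Hc″ j =
        ∣-resp (+-congˡ (-‿cong (distribˡ (H j) (c j) (c′ j))))
          (witness-independent x+y≡Hc″ (mod-trans (mod-+ x≡Hc y≡Hc′) (≈⇒mod (sym (lift-+ H c c′)))) j)

      witness-* : ∀ {x r c c″} → x ≡ lift H c ⟨mod P ^ m ⟩ → r * x ≡ lift H c″ ⟨mod P ^ m ⟩ →
                  ∀ j → G j ∣ H j * c″ j - r * (H j * c j) ⟨mod P ⟩
      witness-* {r = r} {c} x≡Hc rx≡Hc″ j =
        ∣-resp (+-congˡ (-‿cong (solve 3 (λ h r x → h :* (r :* x) := r :* (h :* x)) refl (H j) r (c j))))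
          (witness-independent rx≡Hc″ (mod-trans (mod-*ˡ r x≡Hc) (≈⇒mod (sym (lift-*ˡ H r c)))) j)

ℤ-id : ℤ-rawRing -Raw-AlmostCommutative⟶ fromCommutativeRing ℤ.+-*-commutativeRing
ℤ-id = record
  { ⟦_⟧ = λ a → a ; +-homo = λ _ _ → ≡.refl ; *-homo = λ _ _ → ≡.refl
  ; -‿homo = λ _ → ≡.refl ; 0-homo = ≡.refl ; 1-homo = ≡.refl }

module ℤMod = ℤAlgebra ℤ.+-*-commutativeRing ℤ-id

[mod]⇒⟨mod⟩ : ∀ {a b q} → a ≡ b [mod q ] → ℤMod._≡_⟨mod_⟩ a b (+ q)
[mod]⇒⟨mod⟩ {a} {b} {q} q∣a-b with ℤ∣.divides t a-b≡tq ← ℤ∣.∣ᵤ⇒∣ q∣a-b =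
  ℤMod.witness t (≡.trans (a≡b+[a-b] a b) (≡.cong (λ z → b ℤ.+ z) (≡.trans a-b≡tq (ℤ.*-comm t (+ q)))))
  where
  a≡b+[a-b] : ∀ a b → a ≡ b ℤ.+ (a ℤ.- b)
  a≡b+[a-b] = solve-∀

⟨mod⟩⇒[mod] : ∀ {a b q} → ℤMod._≡_⟨mod_⟩ a b (+ q) → a ≡ b [mod q ]
⟨mod⟩⇒[mod] {a} {b} {q} (ℤMod.witness t a≡b+qt) =
  ℤ∣.∣⇒∣ᵤ (ℤ∣.divides t (≡.trans (≡.cong (ℤ._- b) a≡b+qt) (b+qt-b≡tq b (+ q) t)))
  where
  b+qt-b≡tq : ∀ b q t → b ℤ.+ q ℤ.* t ℤ.- b ≡ t ℤ.* q
  b+qt-b≡tq = solve-∀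

-- The ring ℤ[X]/(Xⁿ − 1) on coefficient vectors

module ℤΣ = SemiringSum ℤ.+-*-semiring

sumFin≡∑ : ∀ k (f : Fin k → ℤ) → sumFin k f ≡ ℤΣ.sum f
sumFin≡∑ zero f = ≡.refl
sumFin≡∑ (suc k) f = ≡.cong (λ s → f Fin.zero ℤ.+ s) (sumFin≡∑ k (f ∘ Fin.suc))

module CyclicIndex (n : ℕ) .{{_ : NonZero n}} where

  infixl 6 _⊕_ _⊖_

  _⊕_ : Fin n → Fin n → Fin n
  i ⊕ j = cyc n (toℕ i ℕ.+ toℕ j)

  _⊖_ : Fin n → Fin n → Fin n
  k ⊖ i = cyc n (toℕ k ℕ.+ n ∸ toℕ i)

  𝟘 𝟙 : Fin n
  𝟘 = cyc n 0
  𝟙 = cyc n 1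

  toℕ-cyc : ∀ t → toℕ (cyc n t) ≡ t % n
  toℕ-cyc t = Fin.toℕ-fromℕ< _

  cyc-toℕ : ∀ i → cyc n (toℕ i) ≡ i
  cyc-toℕ i = Fin.toℕ-injective (≡.trans (toℕ-cyc (toℕ i)) (m<n⇒m%n≡m (Fin.toℕ<n i)))

  cyc-% : ∀ {a b} → a % n ≡ b % n → cyc n a ≡ cyc n b
  cyc-% {a} {b} a≡b = Fin.toℕ-injective (≡.trans (toℕ-cyc a) (≡.trans a≡b (≡.sym (toℕ-cyc b))))

  cyc-+n : ∀ a → cyc n (a ℕ.+ n) ≡ cyc n a
  cyc-+n a = cyc-% ([m+n]%n≡m%n a n)

  cyc-%ˡ : ∀ a b → cyc n (a % n ℕ.+ b) ≡ cyc n (a ℕ.+ b)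
  cyc-%ˡ a b = cyc-% (begin
    (a % n ℕ.+ b) % n             ≡⟨ %-distribˡ-+ (a % n) b n ⟩
    (a % n % n ℕ.+ b % n) % n     ≡⟨ ≡.cong (λ t → (t ℕ.+ b % n) % n) (m%n%n≡m%n a n) ⟩
    (a % n ℕ.+ b % n) % n         ≡⟨ %-distribˡ-+ a b n ⟨
    (a ℕ.+ b) % n                 ∎)
    where open ≡.≡-Reasoning

  ⊕-cycˡ : ∀ a j → cyc n a ⊕ j ≡ cyc n (a ℕ.+ toℕ j)
  ⊕-cycˡ a j = ≡.trans (≡.cong (λ t → cyc n (t ℕ.+ toℕ j)) (toℕ-cyc a)) (cyc-%ˡ a (toℕ j))

  ⊕-comm : ∀ i j → i ⊕ j ≡ j ⊕ i
  ⊕-comm i j = ≡.cong (cyc n) (ℕ.+-comm (toℕ i) (toℕ j))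

  ⊕-cycʳ : ∀ i b → i ⊕ cyc n b ≡ cyc n (toℕ i ℕ.+ b)
  ⊕-cycʳ i b = ≡.trans (⊕-comm i (cyc n b)) (≡.trans (⊕-cycˡ b i) (≡.cong (cyc n) (ℕ.+-comm b (toℕ i))))

  ⊕-assoc : ∀ i j l → i ⊕ j ⊕ l ≡ i ⊕ (j ⊕ l)
  ⊕-assoc i j l = ≡.trans (⊕-cycˡ _ l) (≡.trans (≡.cong (cyc n) (ℕ.+-assoc (toℕ i) (toℕ j) (toℕ l))) (≡.sym (⊕-cycʳ i _)))

  𝟘-⊕ : ∀ j → 𝟘 ⊕ j ≡ j
  𝟘-⊕ j = ≡.trans (⊕-cycˡ 0 j) (cyc-toℕ j)

  ⊕-⊖ : ∀ i k → i ⊕ (k ⊖ i) ≡ k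
  ⊕-⊖ i k = ≡.trans (⊕-cycʳ i _) (≡.trans (≡.cong (cyc n) i+[k+n-i]≡k+n) (≡.trans (cyc-+n (toℕ k)) (cyc-toℕ k)))
    where
    i≤n = ℕ.<⇒≤ (Fin.toℕ<n i)
    i+[k+n-i]≡k+n : toℕ i ℕ.+ (toℕ k ℕ.+ n ∸ toℕ i) ≡ toℕ k ℕ.+ n
    i+[k+n-i]≡k+n = ≡.trans (≡.cong (toℕ i ℕ.+_) (ℕ.+-∸-assoc (toℕ k) i≤n))
                      (≡.trans (x+[y+z]≡y+[x+z] (toℕ i) (toℕ k) _) (≡.cong (toℕ k ℕ.+_) (ℕ.m+[n∸m]≡n i≤n)))

  ⊖-⊕ : ∀ i j → i ⊕ j ⊖ i ≡ j
  ⊖-⊕ i j = begin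
    cyc n (toℕ (i ⊕ j) ℕ.+ n ∸ toℕ i)            ≡⟨ ≡.cong (cyc n) (ℕ.+-∸-assoc (toℕ (i ⊕ j)) i≤n) ⟩
    cyc n (toℕ (i ⊕ j) ℕ.+ (n ∸ toℕ i))          ≡⟨ ≡.cong (λ t → cyc n (t ℕ.+ (n ∸ toℕ i))) (toℕ-cyc _) ⟩
    cyc n ((toℕ i ℕ.+ toℕ j) % n ℕ.+ (n ∸ toℕ i)) ≡⟨ cyc-%ˡ _ _ ⟩
    cyc n (toℕ i ℕ.+ toℕ j ℕ.+ (n ∸ toℕ i))      ≡⟨ ≡.cong (cyc n) [i+j]+[n-i]≡j+n ⟩
    cyc n (toℕ j ℕ.+ n)                          ≡⟨ cyc-+n (toℕ j) ⟩
    cyc n (toℕ j)                                ≡⟨ cyc-toℕ j ⟩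
    j                                            ∎
    where
    open ≡.≡-Reasoning
    i≤n = ℕ.<⇒≤ (Fin.toℕ<n i)
    [i+j]+[n-i]≡j+n : toℕ i ℕ.+ toℕ j ℕ.+ (n ∸ toℕ i) ≡ toℕ j ℕ.+ n
    [i+j]+[n-i]≡j+n = ≡.trans (≡.cong (ℕ._+ (n ∸ toℕ i)) (ℕ.+-comm (toℕ i) (toℕ j)))
                        (≡.trans (ℕ.+-assoc (toℕ j) (toℕ i) _) (≡.cong (toℕ j ℕ.+_) (ℕ.m+[n∸m]≡n i≤n)))

  cyc-⊕ : ∀ a b → cyc n a ⊕ cyc n b ≡ cyc n (a ℕ.+ b)
  cyc-⊕ a b = ≡.trans (⊕-cycˡ a (cyc n b)) (≡.trans (≡.cong (λ t → cyc n (a ℕ.+ t)) (toℕ-cyc b))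
                (≡.trans (≡.cong (cyc n) (ℕ.+-comm a (b % n))) (≡.trans (cyc-%ˡ b a) (≡.cong (cyc n) (ℕ.+-comm b a)))))

  ⊖-unique : ∀ {i j k} → i ⊕ j ≡ k → j ≡ k ⊖ i
  ⊖-unique {i} {j} ≡.refl = ≡.sym (⊖-⊕ i j)

  ⊖-involutive : ∀ k i → k ⊖ (k ⊖ i) ≡ i
  ⊖-involutive k i = ≡.sym (⊖-unique (≡.trans (⊕-comm (k ⊖ i) i) (⊕-⊖ i k)))

  ⊖-⊕ʳ : ∀ k i j → k ⊖ (i ⊕ j) ≡ k ⊖ i ⊖ j
  ⊖-⊕ʳ k i j = ≡.sym (⊖-unique (≡.trans (⊕-assoc i j _) (≡.trans (≡.cong (i ⊕_) (⊕-⊖ j (k ⊖ i))) (⊕-⊖ i k))))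

  ⊖-𝟘 : ∀ k → k ⊖ 𝟘 ≡ k
  ⊖-𝟘 k = ≡.sym (⊖-unique (𝟘-⊕ k))

  cyc-pred : ∀ k → cyc n (toℕ k ℕ.+ n ∸ 1) ≡ k ⊖ 𝟙
  cyc-pred k = ⊖-unique (≡.trans (cyc-⊕ 1 _) (≡.trans (≡.cong (cyc n) 1+[k+n-1]≡k+n) (≡.trans (cyc-+n (toℕ k)) (cyc-toℕ k))))
    where
    1+[k+n-1]≡k+n : 1 ℕ.+ (toℕ k ℕ.+ n ∸ 1) ≡ toℕ k ℕ.+ n
    1+[k+n-1]≡k+n = ℕ.m+[n∸m]≡n (ℕ.≤-trans (ℕ.n≢0⇒n>0 (ℕ.≢-nonZero⁻¹ n)) (ℕ.m≤n+m n (toℕ k)))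

  reflection : Fin n → Permutation′ n
  reflection k = permutation (k ⊖_) (k ⊖_) (⊖-involutive k) (⊖-involutive k)

  rotation : Fin n → Permutation′ n
  rotation i = permutation (i ⊕_) (_⊖ i) (⊕-⊖ i) (⊖-⊕ i)

single : ∀ {n} → Fin n → ℤ → Vecℤ n
single t a i with i Fin.≟ t
... | yes _ = a
... | no  _ = 0ℤ

single-diag : ∀ {n} (t : Fin n) a → single t a t ≡ a
single-diag t a with t Fin.≟ t
... | yes _ = ≡.refl
... | no t≢t = contradiction ≡.refl t≢t

single-off : ∀ {n} {t i : Fin n} a → i ≢ t → single t a i ≡ 0ℤ
single-off {t = t} {i} a i≢t with i Fin.≟ t
... | yes i≡t = contradiction i≡t i≢t
... | no  _ = ≡.refl

∑-single : ∀ {n} (t : Fin n) a (f : Vecℤ n) → ℤΣ.sum (λ i → single t a i ℤ.* f i) ≡ a ℤ.* f t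
∑-single {suc n} t a f = begin
  ℤΣ.sum (λ i → single t a i ℤ.* f i)
    ≡⟨ ℤΣ.sum-remove {i = t} (λ i → single t a i ℤ.* f i) ⟩
  single t a t ℤ.* f t ℤ.+ ℤΣ.sum (λ i → single t a (Fin.punchIn t i) ℤ.* f (Fin.punchIn t i))
    ≡⟨ ≡.cong₂ ℤ._+_ (≡.cong (ℤ._* f t) (single-diag t a))
        (ℤΣ.sum-cong-≗ {n} λ i → ≡.cong (ℤ._* f (Fin.punchIn t i)) (single-off a (Fin.punchInᵢ≢i t i))) ⟩
  a ℤ.* f t ℤ.+ ℤΣ.sum {n} (λ _ → 0ℤ)
    ≡⟨ ≡.cong (λ s → a ℤ.* f t ℤ.+ s) (ℤΣ.sum-replicate-zero n) ⟩
  a ℤ.* f t ℤ.+ 0ℤ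
    ≡⟨ ℤ.+-identityʳ _ ⟩
  a ℤ.* f t
    ∎
  where open ≡.≡-Reasoning

module _ {n} (t : Fin n) where

  single-+ : ∀ a b → single t (a ℤ.+ b) ≗ single t a +v single t b
  single-+ a b i with i Fin.≟ t
  ... | yes _ = ≡.refl
  ... | no  _ = ≡.refl

  single-*ˡ : ∀ a b → single t (a ℤ.* b) ≗ a ·v single t b
  single-*ˡ a b i with i Fin.≟ t
  ... | yes _ = ≡.refl
  ... | no  _ = ≡.sym (ℤ.*-zeroʳ a)

  single-neg : ∀ a i → single t (ℤ.- a) i ≡ ℤ.- single t a i
  single-neg a i with i Fin.≟ t
  ... | yes _ = ≡.refl
  ... | no  _ = ≡.refl

  single-0 : single t 0ℤ ≗ 0v
  single-0 i with i Fin.≟ t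
  ... | yes _ = ≡.refl
  ... | no  _ = ≡.refl

module Convolution (n : ℕ) .{{_ : NonZero n}} where

  open CyclicIndex n
  open ≡.≡-Reasoning

  conv-∑ : ∀ a b k → conv n a b k ≡ ℤΣ.sum (λ i → a i ℤ.* b (k ⊖ i))
  conv-∑ a b k = sumFin≡∑ n _

  conv-cong : ∀ {a a′ b b′} → a ≗ a′ → b ≗ b′ → conv n a b ≗ conv n a′ b′
  conv-cong {a} {a′} {b} {b′} a≗a′ b≗b′ k = begin
    conv n a b k                          ≡⟨ conv-∑ a b k ⟩
    ℤΣ.sum (λ i → a i ℤ.* b (k ⊖ i))      ≡⟨ ℤΣ.sum-cong-≗ (λ i → ≡.cong₂ ℤ._*_ (a≗a′ i) (b≗b′ (k ⊖ i))) ⟩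
    ℤΣ.sum (λ i → a′ i ℤ.* b′ (k ⊖ i))    ≡⟨ conv-∑ a′ b′ k ⟨
    conv n a′ b′ k                        ∎

  conv-comm : ∀ a b → conv n a b ≗ conv n b a
  conv-comm a b k = begin
    conv n a b k
      ≡⟨ conv-∑ a b k ⟩
    ℤΣ.sum (λ i → a i ℤ.* b (k ⊖ i))
      ≡⟨ ℤΣ.∑-permute (λ i → a i ℤ.* b (k ⊖ i)) (reflection k) ⟩
    ℤΣ.sum (λ i → a (k ⊖ i) ℤ.* b (k ⊖ (k ⊖ i)))
      ≡⟨ ℤΣ.sum-cong-≗ (λ i → ≡.trans (≡.cong (λ j → a (k ⊖ i) ℤ.* b j) (⊖-involutive k i)) (ℤ.*-comm (a (k ⊖ i)) (b i))) ⟩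
    ℤΣ.sum (λ i → b i ℤ.* a (k ⊖ i))
      ≡⟨ conv-∑ b a k ⟨
    conv n b a k
      ∎

  conv-assoc : ∀ a b c → conv n (conv n a b) c ≗ conv n a (conv n b c)
  conv-assoc a b c k = begin
    conv n (conv n a b) c k
      ≡⟨ conv-∑ (conv n a b) c k ⟩
    ℤΣ.sum (λ l → conv n a b l ℤ.* c (k ⊖ l))
      ≡⟨ ℤΣ.sum-cong-≗ (λ l → ≡.trans (≡.cong (ℤ._* c (k ⊖ l)) (conv-∑ a b l)) (ℤΣ.*-distribʳ-sum (c (k ⊖ l)) (λ i → a i ℤ.* b (l ⊖ i)))) ⟩
    ℤΣ.sum (λ l → ℤΣ.sum (λ i → a i ℤ.* b (l ⊖ i) ℤ.* c (k ⊖ l)))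
      ≡⟨ ℤΣ.∑-comm (λ l i → a i ℤ.* b (l ⊖ i) ℤ.* c (k ⊖ l)) ⟩
    ℤΣ.sum (λ i → ℤΣ.sum (λ l → a i ℤ.* b (l ⊖ i) ℤ.* c (k ⊖ l)))
      ≡⟨ ℤΣ.sum-cong-≗ (λ i → ℤΣ.∑-permute (λ l → a i ℤ.* b (l ⊖ i) ℤ.* c (k ⊖ l)) (rotation i)) ⟩
    ℤΣ.sum (λ i → ℤΣ.sum (λ j → a i ℤ.* b (i ⊕ j ⊖ i) ℤ.* c (k ⊖ (i ⊕ j))))
      ≡⟨ ℤΣ.sum-cong-≗ (λ i → ℤΣ.sum-cong-≗
          (λ j → ≡.trans (≡.cong₂ (λ u v → a i ℤ.* b u ℤ.* c v) (⊖-⊕ i j) (⊖-⊕ʳ k i j)) (ℤ.*-assoc (a i) (b j) (c (k ⊖ i ⊖ j))))) ⟩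
    ℤΣ.sum (λ i → ℤΣ.sum (λ j → a i ℤ.* (b j ℤ.* c (k ⊖ i ⊖ j))))
      ≡⟨ ℤΣ.sum-cong-≗ (λ i → ≡.trans (≡.cong (a i ℤ.*_) (conv-∑ b c (k ⊖ i))) (ℤΣ.*-distribˡ-sum (a i) (λ j → b j ℤ.* c (k ⊖ i ⊖ j)))) ⟨
    ℤΣ.sum (λ i → a i ℤ.* conv n b c (k ⊖ i))
      ≡⟨ conv-∑ a (conv n b c) k ⟨
    conv n a (conv n b c) k
      ∎

  conv-distribˡ : ∀ a b c → conv n a (b +v c) ≗ conv n a b +v conv n a c
  conv-distribˡ a b c k = begin
    conv n a (b +v c) k
      ≡⟨ conv-∑ a (b +v c) k ⟩
    ℤΣ.sum (λ i → a i ℤ.* (b (k ⊖ i) ℤ.+ c (k ⊖ i)))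
      ≡⟨ ℤΣ.sum-cong-≗ (λ i → ℤ.*-distribˡ-+ (a i) (b (k ⊖ i)) (c (k ⊖ i))) ⟩
    ℤΣ.sum (λ i → a i ℤ.* b (k ⊖ i) ℤ.+ a i ℤ.* c (k ⊖ i))
      ≡⟨ ℤΣ.∑-distrib-+ (λ i → a i ℤ.* b (k ⊖ i)) (λ i → a i ℤ.* c (k ⊖ i)) ⟩
    ℤΣ.sum (λ i → a i ℤ.* b (k ⊖ i)) ℤ.+ ℤΣ.sum (λ i → a i ℤ.* c (k ⊖ i))
      ≡⟨ ≡.cong₂ ℤ._+_ (conv-∑ a b k) (conv-∑ a c k) ⟨
    conv n a b k ℤ.+ conv n a c k
      ∎

  conv-single : ∀ t a v k → conv n (single t a) v k ≡ a ℤ.* v (k ⊖ t)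
  conv-single t a v k = ≡.trans (conv-∑ (single t a) v k) (∑-single t a (λ i → v (k ⊖ i)))

  ι : ℤ → Vecℤ n
  ι = single 𝟘

  conv-ι : ∀ a v → conv n (ι a) v ≗ a ·v v
  conv-ι a v k = ≡.trans (conv-single 𝟘 a v k) (≡.cong (λ i → a ℤ.* v i) (⊖-𝟘 k))

  X : Vecℤ n
  X = single 𝟙 1ℤ

  conv-X : ∀ v → conv n X v ≗ σcyc n v
  conv-X v k = ≡.trans (conv-single 𝟙 1ℤ v k) (≡.trans (ℤ.*-identityˡ _) (≡.cong v (≡.sym (cyc-pred k))))

  infixl 7 _⊛_
  infixl 6 _⊞_

  -- The operations are opaque, so that unification treats them as neutral; ⊞≗+v, ⊛≗conv and ⊟-apply
  -- are the only way to compute with them.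
  opaque
    _⊞_ : Vecℤ n → Vecℤ n → Vecℤ n
    _⊞_ = _+v_

    _⊛_ : Vecℤ n → Vecℤ n → Vecℤ n
    _⊛_ = conv n

    ⊟_ : Vecℤ n → Vecℤ n
    ⊟ x = λ i → ℤ.- x i

    ⊞≗+v : ∀ x y → x ⊞ y ≗ x +v y
    ⊞≗+v x y _ = ≡.refl

    ⊛≗conv : ∀ x y → x ⊛ y ≗ conv n x y
    ⊛≗conv x y _ = ≡.refl

    ⊟-apply : ∀ x k → (⊟ x) k ≡ ℤ.- x k
    ⊟-apply x k = ≡.refl

  opaque
    unfolding _⊞_ _⊛_ ⊟_

    isCommutativeRing : IsCommutativeRing _≗_ _⊞_ _⊛_ ⊟_ 0v (ι 1ℤ)
    isCommutativeRing = record
      { isRing = record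
        { +-isAbelianGroup = Pointwise.isAbelianGroup (Fin n) ℤ.+-0-isAbelianGroup
        ; *-cong = conv-cong
        ; *-assoc = conv-assoc
        ; *-identity = identityˡ , λ v k → ≡.trans (conv-comm v (ι 1ℤ) k) (identityˡ v k)
        ; distrib = conv-distribˡ , λ a b c k → ≡.trans (conv-comm (b +v c) a k)
                      (≡.trans (conv-distribˡ a b c k) (≡.cong₂ ℤ._+_ (conv-comm a b k) (conv-comm a c k)))
        }
      ; *-comm = conv-comm
      }
      where
      identityˡ : ∀ v → conv n (ι 1ℤ) v ≗ v
      identityˡ v k = ≡.trans (conv-ι 1ℤ v k) (ℤ.*-identityˡ (v k))

  ℤ[X]/⟨Xⁿ-1⟩ : CommutativeRing 0ℓ 0ℓ
  ℤ[X]/⟨Xⁿ-1⟩ = record { isCommutativeRing = isCommutativeRing }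

  ι-⊛ : ∀ a v → ι a ⊛ v ≗ a ·v v
  ι-⊛ a v k = ≡.trans (⊛≗conv (ι a) v k) (conv-ι a v k)

  X-⊛ : ∀ v → X ⊛ v ≗ σcyc n v
  X-⊛ v k = ≡.trans (⊛≗conv X v k) (conv-X v k)

  ι-hom : ℤ-rawRing -Raw-AlmostCommutative⟶ fromCommutativeRing ℤ[X]/⟨Xⁿ-1⟩
  ι-hom = record
    { ⟦_⟧ = ι
    ; +-homo = λ a b k → ≡.trans (single-+ 𝟘 a b k) (≡.sym (⊞≗+v (ι a) (ι b) k))
    ; *-homo = λ a b k → ≡.trans (single-*ˡ 𝟘 a b k) (≡.sym (ι-⊛ a (ι b) k))
    ; -‿homo = λ a k → ≡.trans (single-neg 𝟘 a k) (≡.sym (⊟-apply (ι a) k))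
    ; 0-homo = single-0 𝟘
    ; 1-homo = λ _ → ≡.refl
    }

-- Polynomials modulo Xⁿ − 1

sumℕ≡∑ : ∀ L f → sumℕ L f ≡ ℤΣ.sum (λ (i : Fin L) → f (toℕ i))
sumℕ≡∑ zero f = ≡.refl
sumℕ≡∑ (suc L) f = begin
  sumℕ L f ℤ.+ f L
    ≡⟨ ≡.cong₂ ℤ._+_ (sumℕ≡∑ L f) (≡.cong f (≡.sym (Fin.toℕ-fromℕ L))) ⟩
  ℤΣ.sum (λ (i : Fin L) → f (toℕ i)) ℤ.+ f (toℕ (Fin.fromℕ L))
    ≡⟨ ≡.cong (ℤ._+ f (toℕ (Fin.fromℕ L))) (ℤΣ.sum-cong-≗ {L} (λ i → ≡.cong f (≡.sym (Fin.toℕ-inject₁ i)))) ⟩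
  ℤΣ.sum (λ (i : Fin L) → f (toℕ (Fin.inject₁ i))) ℤ.+ f (toℕ (Fin.fromℕ L))
    ≡⟨ ℤΣ.sum-init-last {L} (λ i → f (toℕ i)) ⟨
  ℤΣ.sum (λ (i : Fin (suc L)) → f (toℕ i))
    ∎
  where
  open ≡.≡-Reasoning

sumℕ-suc : ∀ L f → sumℕ (suc L) f ≡ f 0 ℤ.+ sumℕ L (f ∘ suc)
sumℕ-suc L f = ≡.trans (sumℕ≡∑ (suc L) f) (≡.cong (λ z → f 0 ℤ.+ z) (≡.sym (sumℕ≡∑ L (f ∘ suc))))

sumℕ-cong : ∀ L {f g} → (∀ i → i < L → f i ≡ g i) → sumℕ L f ≡ sumℕ L g
sumℕ-cong L {f} {g} f≡g = ≡.trans (sumℕ≡∑ L f)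
  (≡.trans (ℤΣ.sum-cong-≗ {L} (λ i → f≡g (toℕ i) (Fin.toℕ<n i))) (≡.sym (sumℕ≡∑ L g)))

sumℕ-+ : ∀ L f g → sumℕ L (λ i → f i ℤ.+ g i) ≡ sumℕ L f ℤ.+ sumℕ L g
sumℕ-+ L f g = ≡.trans (sumℕ≡∑ L _) (≡.trans (ℤΣ.∑-distrib-+ (λ (i : Fin L) → f (toℕ i)) (λ i → g (toℕ i)))
  (≡.sym (≡.cong₂ ℤ._+_ (sumℕ≡∑ L f) (sumℕ≡∑ L g))))

sumℕ-*ˡ : ∀ L c f → sumℕ L (λ i → c ℤ.* f i) ≡ c ℤ.* sumℕ L f
sumℕ-*ˡ L c f = ≡.trans (sumℕ≡∑ L _) (≡.trans (≡.sym (ℤΣ.*-distribˡ-sum c (λ (i : Fin L) → f (toℕ i))))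
  (≡.cong (c ℤ.*_) (≡.sym (sumℕ≡∑ L f))))

sumℕ-zero : ∀ L {f} → (∀ i → i < L → f i ≡ 0ℤ) → sumℕ L f ≡ 0ℤ
sumℕ-zero L {f} f≡0 = ≡.trans (sumℕ-cong L f≡0) (≡.trans (sumℕ≡∑ L _) (ℤΣ.sum-replicate-zero L))

coeff-vanishes : ∀ f {i} → length f ≤ i → coeff f i ≡ 0ℤ
coeff-vanishes []      _ = ≡.refl
coeff-vanishes (a ∷ f) {suc i} (ℕ.s≤s lf≤i) = coeff-vanishes f lf≤i

mulCoeff-[] : ∀ g k → mulCoeff [] g k ≡ 0ℤ
mulCoeff-[] g k = sumℕ-zero (suc k) (λ _ _ → ≡.refl)

mulCoeff-∷-zero : ∀ a f g → mulCoeff (a ∷ f) g 0 ≡ a ℤ.* coeff g 0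
mulCoeff-∷-zero a f g = ℤ.+-identityˡ _

mulCoeff-∷-suc : ∀ a f g k → mulCoeff (a ∷ f) g (suc k) ≡ a ℤ.* coeff g (suc k) ℤ.+ mulCoeff f g k
mulCoeff-∷-suc a f g k = sumℕ-suc (suc k) _

mulCoeff-vanishes : ∀ f g {k} → length f ℕ.+ length g ≤ k → mulCoeff f g k ≡ 0ℤ
mulCoeff-vanishes f g {k} lf+lg≤k = sumℕ-zero (suc k) term≡0
  where
  term≡0 : ∀ i → i < suc k → coeff f i ℤ.* coeff g (k ∸ i) ≡ 0ℤ
  term≡0 i i<1+k with ℕ.<-≤-connex i (length f)
  ... | inj₂ lf≤i = ≡.cong (ℤ._* coeff g (k ∸ i)) (coeff-vanishes f lf≤i)
  ... | inj₁ i<lf = ≡.trans (≡.cong (coeff f i ℤ.*_) (coeff-vanishes g lg≤k-i)) (ℤ.*-zeroʳ (coeff f i))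
    where
    lg≤k-i : length g ≤ k ∸ i
    lg≤k-i = ℕ.≤-trans (ℕ.≤-trans (ℕ.m≤n+m (length g) (length f ∸ i))
                          (ℕ.≤-reflexive (≡.sym (ℕ.+-∸-comm (length g) (ℕ.<⇒≤ i<lf)))))
                        (ℕ.∸-monoˡ-≤ i lf+lg≤k)

xⁿ-1-zero : ∀ n .{{_ : NonZero n}} → xⁿ-1 n 0 ≡ -1ℤ
xⁿ-1-zero (suc _) = ≡.refl

xⁿ-1-n : ∀ n → xⁿ-1 n n ≡ 1ℤ
xⁿ-1-n n with n ≡ᵇ n in eq
... | true  = ≡.refl
... | false = ⊥-elim (≡.subst T eq (ℕ.≡⇒≡ᵇ n n ≡.refl))

xⁿ-1-other : ∀ n k → 0 < k → k ≢ n → xⁿ-1 n k ≡ 0ℤ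
xⁿ-1-other n (suc k) _ k≢n with suc k ≡ᵇ n in eq
... | true  = contradiction (ℕ.≡ᵇ⇒≡ (suc k) n (≡.subst T (≡.sym eq) tt)) k≢n
... | false = ≡.refl

-- weight c 0 is the operator X d/dX + c.
weight : ℤ → ℕ → List ℤ → List ℤ
weight c s []      = []
weight c s (a ∷ f) = (+ s ℤ.+ c) ℤ.* a ∷ weight c (suc s) f

coeff-weight : ∀ c s f k → coeff (weight c s f) k ≡ (+ (s ℕ.+ k) ℤ.+ c) ℤ.* coeff f k
coeff-weight c s []      k       = ≡.sym (ℤ.*-zeroʳ (+ (s ℕ.+ k) ℤ.+ c))
coeff-weight c s (a ∷ f) zero    = ≡.cong (λ t → (+ t ℤ.+ c) ℤ.* a) (≡.sym (ℕ.+-identityʳ s))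
coeff-weight c s (a ∷ f) (suc k) =
  ≡.trans (coeff-weight c (suc s) f k) (≡.cong (λ t → (+ t ℤ.+ c) ℤ.* coeff f k) (≡.sym (ℕ.+-suc s k)))

mulCoeff-weight : ∀ a b f g k → mulCoeff (weight a 0 f) g k ℤ.+ mulCoeff f (weight b 0 g) k
                                ≡ (+ k ℤ.+ a ℤ.+ b) ℤ.* mulCoeff f g k
mulCoeff-weight a b f g k =
  ≡.trans (≡.sym (sumℕ-+ (suc k) (λ i → coeff (weight a 0 f) i ℤ.* coeff g (k ∸ i)) (λ i → coeff f i ℤ.* coeff (weight b 0 g) (k ∸ i))))
    (≡.trans (sumℕ-cong (suc k) term) (sumℕ-*ˡ (suc k) (+ k ℤ.+ a ℤ.+ b) (λ i → coeff f i ℤ.* coeff g (k ∸ i))))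
  where
  distribute : ∀ x y a b F G → (x ℤ.+ a) ℤ.* F ℤ.* G ℤ.+ F ℤ.* ((y ℤ.+ b) ℤ.* G) ≡ (x ℤ.+ y ℤ.+ a ℤ.+ b) ℤ.* (F ℤ.* G)
  distribute = solve-∀
  term : ∀ i → i < suc k → coeff (weight a 0 f) i ℤ.* coeff g (k ∸ i) ℤ.+ coeff f i ℤ.* coeff (weight b 0 g) (k ∸ i)
                           ≡ (+ k ℤ.+ a ℤ.+ b) ℤ.* (coeff f i ℤ.* coeff g (k ∸ i))
  term i i<1+k = ≡.trans (≡.cong₂ (λ x y → x ℤ.* coeff g (k ∸ i) ℤ.+ coeff f i ℤ.* y) (coeff-weight a 0 f i) (coeff-weight b 0 g (k ∸ i)))
    (≡.trans (distribute (+ i) (+ (k ∸ i)) a b (coeff f i) (coeff g (k ∸ i)))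
      (≡.cong (λ x → (x ℤ.+ a ℤ.+ b) ℤ.* (coeff f i ℤ.* coeff g (k ∸ i)))
        (≡.trans (≡.sym (ℤ.pos-+ i (k ∸ i))) (≡.cong +_ (ℕ.m+[n∸m]≡n (ℕ.s≤s⁻¹ i<1+k))))))

module Polynomials (n : ℕ) .{{_ : NonZero n}} where

  open CyclicIndex n
  open Convolution n
  open ℤAlgebra ℤ[X]/⟨Xⁿ-1⟩ ι-hom

  -- residue L t is the class of Σ_{i<L} t i Xⁱ; reduce n f is residue (length f) (coeff f).
  residue : ℕ → (ℕ → ℤ) → Vecℤ n
  residue L t k = sumℕ L (λ i → if (i % n) ≡ᵇ toℕ k then t i else 0ℤ)

  if≡single : ∀ i x k → (if (i % n) ≡ᵇ toℕ k then x else 0ℤ) ≡ single (cyc n i) x k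
  if≡single i x k with (i % n) ≡ᵇ toℕ k in eq | k Fin.≟ cyc n i
  ... | true  | yes _ = ≡.refl
  ... | false | no  _ = ≡.refl
  ... | true  | no k≢i =
    contradiction (Fin.toℕ-injective (≡.trans (≡.sym (ℕ.≡ᵇ⇒≡ _ _ (≡.subst T (≡.sym eq) tt))) (≡.sym (toℕ-cyc i)))) k≢i
  ... | false | yes ≡.refl = ⊥-elim (≡.subst T eq (ℕ.≡⇒≡ᵇ _ _ (≡.sym (toℕ-cyc i))))

  single-⊕ : ∀ i j x k → single (i ⊕ j) x k ≡ single j x (k ⊖ i)
  single-⊕ i j x k with k Fin.≟ i ⊕ j | k ⊖ i Fin.≟ j
  ... | yes _ | yes _ = ≡.refl
  ... | no  _ | no  _ = ≡.refl
  ... | yes ≡.refl | no k⊖i≢j = contradiction (⊖-⊕ i j) k⊖i≢j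
  ... | no k≢i⊕j | yes ≡.refl = contradiction (≡.sym (⊕-⊖ i k)) k≢i⊕j

  residue-suc : ∀ L t → residue (suc L) t ≈ ι (t 0) + X * residue L (t ∘ suc)
  residue-suc L t k = begin
    residue (suc L) t k
      ≡⟨ sumℕ-suc L _ ⟩
    (if 0 % n ≡ᵇ toℕ k then t 0 else 0ℤ) ℤ.+ sumℕ L (λ i → if (suc i % n) ≡ᵇ toℕ k then t (suc i) else 0ℤ)
      ≡⟨ ≡.cong₂ ℤ._+_ (if≡single 0 (t 0) k) (sumℕ-cong L (λ i _ → shift i)) ⟩
    ι (t 0) k ℤ.+ residue L (t ∘ suc) (cyc n (toℕ k ℕ.+ n ∸ 1))
      ≡⟨ ≡.cong (λ z → ι (t 0) k ℤ.+ z) (X-⊛ (residue L (t ∘ suc)) k) ⟨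
    ι (t 0) k ℤ.+ (X * residue L (t ∘ suc)) k
      ≡⟨ ⊞≗+v (ι (t 0)) (X * residue L (t ∘ suc)) k ⟨
    (ι (t 0) + X * residue L (t ∘ suc)) k
      ∎
    where
    open ≡.≡-Reasoning
    shift : ∀ i → (if (suc i % n) ≡ᵇ toℕ k then t (suc i) else 0ℤ)
                ≡ (if (i % n) ≡ᵇ toℕ (cyc n (toℕ k ℕ.+ n ∸ 1)) then t (suc i) else 0ℤ)
    shift i = begin
      _                                           ≡⟨ if≡single (suc i) (t (suc i)) k ⟩
      single (cyc n (suc i)) (t (suc i)) k         ≡⟨ ≡.cong (λ j → single j (t (suc i)) k) (≡.sym (cyc-⊕ 1 i)) ⟩
      single (𝟙 ⊕ cyc n i) (t (suc i)) k           ≡⟨ single-⊕ 𝟙 (cyc n i) (t (suc i)) k ⟩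
      single (cyc n i) (t (suc i)) (k ⊖ 𝟙)         ≡⟨ ≡.cong (single (cyc n i) (t (suc i))) (cyc-pred k) ⟨
      single (cyc n i) (t (suc i)) (cyc n (toℕ k ℕ.+ n ∸ 1)) ≡⟨ if≡single i (t (suc i)) _ ⟨
      _                                           ∎

  ι-cong : ∀ {a b} → a ≡ b → ι a ≈ ι b
  ι-cong a≡b _ = ≡.cong (λ x → single 𝟘 x _) a≡b

  residue-single : ∀ L t k → residue L t k ≡ sumℕ L (λ i → single (cyc n i) (t i) k)
  residue-single L t k = sumℕ-cong L (λ i _ → if≡single i (t i) k)

  residue-cong : ∀ L {t u} → (∀ i → i < L → t i ≡ u i) → residue L t ≈ residue L u
  residue-cong L t≡u k = sumℕ-cong L (λ i i<L → ≡.cong (λ x → if (i % n) ≡ᵇ toℕ k then x else 0ℤ) (t≡u i i<L))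

  residue-+ : ∀ L t u → residue L (λ i → t i ℤ.+ u i) ≈ residue L t + residue L u
  residue-+ L t u k = begin
    residue L (λ i → t i ℤ.+ u i) k                                          ≡⟨ residue-single L _ k ⟩
    sumℕ L (λ i → single (cyc n i) (t i ℤ.+ u i) k)                       ≡⟨ sumℕ-cong L (λ i _ → single-+ (cyc n i) (t i) (u i) k) ⟩
    sumℕ L (λ i → single (cyc n i) (t i) k ℤ.+ single (cyc n i) (u i) k)   ≡⟨ sumℕ-+ L _ _ ⟩
    _                                                                     ≡⟨ ≡.cong₂ ℤ._+_ (residue-single L t k) (residue-single L u k) ⟨
    residue L t k ℤ.+ residue L u k                                             ≡⟨ ⊞≗+v (residue L t) (residue L u) k ⟨
    (residue L t + residue L u) k                                               ∎
    where open ≡.≡-Reasoning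

  residue-*ˡ : ∀ L a t → residue L (λ i → a ℤ.* t i) ≈ ι a * residue L t
  residue-*ˡ L a t k = begin
    residue L (λ i → a ℤ.* t i) k                         ≡⟨ residue-single L _ k ⟩
    sumℕ L (λ i → single (cyc n i) (a ℤ.* t i) k)      ≡⟨ sumℕ-cong L (λ i _ → single-*ˡ (cyc n i) a (t i) k) ⟩
    sumℕ L (λ i → a ℤ.* single (cyc n i) (t i) k)      ≡⟨ sumℕ-*ˡ L a _ ⟩
    a ℤ.* sumℕ L (λ i → single (cyc n i) (t i) k)      ≡⟨ ≡.cong (a ℤ.*_) (residue-single L t k) ⟨
    a ℤ.* residue L t k                                   ≡⟨ ι-⊛ a (residue L t) k ⟨
    (ι a * residue L t) k                                 ∎
    where open ≡.≡-Reasoning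

  residue-zero : ∀ L {t} → (∀ i → i < L → t i ≡ 0ℤ) → residue L t ≈ 0#
  residue-zero L t≡0 k = ≡.trans (residue-single L _ k)
    (sumℕ-zero L (λ i i<L → ≡.trans (≡.cong (λ x → single (cyc n i) x k) (t≡0 i i<L)) (single-0 (cyc n i) k)))

  residue-extend : ∀ {L L′} t → (∀ i → L ≤ i → t i ≡ 0ℤ) → L ≤ L′ → residue L′ t ≈ residue L t
  residue-extend {L} {L′} t t≡0 L≤L′ with ℕ.m≤n⇒m<n∨m≡n L≤L′
  ... | inj₂ ≡.refl = λ _ → ≡.refl
  ... | inj₁ L<L′ with L′
  ...   | suc L″ = λ k → ≡.trans (≡.cong₂ ℤ._+_ (residue-extend t t≡0 (ℕ.s≤s⁻¹ L<L′) k) (last≡0 k)) (ℤ.+-identityʳ _)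
    where
    last≡0 : ∀ k → (if (L″ % n) ≡ᵇ toℕ k then t L″ else 0ℤ) ≡ 0ℤ
    last≡0 k = ≡.trans (if≡single L″ (t L″) k)
                 (≡.trans (≡.cong (λ x → single (cyc n L″) x k) (t≡0 L″ (ℕ.s≤s⁻¹ L<L′))) (single-0 (cyc n L″) k))

  reduce-∷ : ∀ a f → reduce n (a ∷ f) ≈ ι a + X * reduce n f
  reduce-∷ a f = residue-suc (length f) (coeff (a ∷ f))

  reduce≈residue : ∀ f {L} → length f ≤ L → reduce n f ≈ residue L (coeff f)
  reduce≈residue f lf≤L = sym (residue-extend (coeff f) (λ i → coeff-vanishes f) lf≤L)

  reduce-* : ∀ f g → reduce n f * reduce n g ≈ residue (length f ℕ.+ length g) (mulCoeff f g)
  reduce-* [] g = trans (zeroˡ (reduce n g)) (sym (residue-zero (length g) (λ i _ → mulCoeff-[] g i)))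
  reduce-* (a ∷ f) g = begin
    reduce n (a ∷ f) * reduce n g
      ≈⟨ *-cong (reduce-∷ a f) rg≈ ⟩
    (ι a + X * reduce n f) * (ι (coeff g 0) + X * G′)
      ≈⟨ solve 5 (λ A x F B G → (A :+ x :* F) :* (B :+ x :* G) := A :* B :+ x :* (A :* G :+ F :* (B :+ x :* G))) refl
           (ι a) X (reduce n f) (ι (coeff g 0)) G′ ⟩
    ι a * ι (coeff g 0) + X * (ι a * G′ + reduce n f * (ι (coeff g 0) + X * G′))
      ≈⟨ +-cong (sym (*-homo a (coeff g 0))) (*-congˡ (+-cong (sym (residue-*ˡ L a (coeff g ∘ suc)))
           (trans (*-congˡ (sym rg≈)) (reduce-* f g)))) ⟩
    ι (a ℤ.* coeff g 0) + X * (residue L (λ i → a ℤ.* coeff g (suc i)) + residue L (mulCoeff f g))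
      ≈⟨ +-cong (ι-cong (≡.sym (mulCoeff-∷-zero a f g))) (*-congˡ (sym (residue-+ L _ _))) ⟩
    ι (mulCoeff (a ∷ f) g 0) + X * residue L (λ i → a ℤ.* coeff g (suc i) ℤ.+ mulCoeff f g i)
      ≈⟨ +-congˡ (*-congˡ (residue-cong L (λ i _ → ≡.sym (mulCoeff-∷-suc a f g i)))) ⟩
    ι (mulCoeff (a ∷ f) g 0) + X * residue L (mulCoeff (a ∷ f) g ∘ suc)
      ≈⟨ residue-suc L (mulCoeff (a ∷ f) g) ⟨
    residue (suc L) (mulCoeff (a ∷ f) g)
      ∎
    where
    open import Relation.Binary.Reasoning.Setoid setoid
    open _-Raw-AlmostCommutative⟶_ ι-hom using (*-homo)
    L = length f ℕ.+ length g
    G′ = residue L (coeff g ∘ suc)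
    rg≈ : reduce n g ≈ ι (coeff g 0) + X * G′
    rg≈ = trans (reduce≈residue g (ℕ.≤-trans (ℕ.m≤n+m (length g) (length f)) (ℕ.n≤1+n _))) (residue-suc L (coeff g))

  residue-concentrated : ∀ L t → 0 < L → (∀ i → 0 < i → i < L → t i ≡ 0ℤ) → residue L t ≈ ι (t 0)
  residue-concentrated (suc L) t _ t≡0 = begin
    residue (suc L) t
      ≈⟨ residue-suc L t ⟩
    ι (t 0) + X * residue L (t ∘ suc)
      ≈⟨ +-congˡ (trans (*-congˡ (residue-zero L (λ i i<L → t≡0 (suc i) (ℕ.s≤s ℕ.z≤n) (ℕ.s≤s i<L)))) (zeroʳ X)) ⟩
    ι (t 0) + 0#
      ≈⟨ +-identityʳ _ ⟩
    ι (t 0)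
      ∎
    where open import Relation.Binary.Reasoning.Setoid setoid

  residue-Xⁿ-1 : ∀ {L} → suc n ≤ L → residue L (xⁿ-1 n) ≈ 0#
  residue-Xⁿ-1 1+n≤L k = ≡.trans (residue-extend (xⁿ-1 n) vanishes 1+n≤L k) (begin
    residue n (xⁿ-1 n) k ℤ.+ (if (n % n) ≡ᵇ toℕ k then xⁿ-1 n n else 0ℤ)
      ≡⟨ ≡.cong₂ ℤ._+_ (residue-concentrated n (xⁿ-1 n) 0<n middle k) (if≡single n (xⁿ-1 n n) k) ⟩
    ι (xⁿ-1 n 0) k ℤ.+ single (cyc n n) (xⁿ-1 n n) k
      ≡⟨ ≡.cong₂ (λ a b → ι a k ℤ.+ single (cyc n n) b k) (xⁿ-1-zero n) (xⁿ-1-n n) ⟩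
    ι -1ℤ k ℤ.+ single (cyc n n) 1ℤ k
      ≡⟨ ≡.cong (λ j → ι -1ℤ k ℤ.+ single j 1ℤ k) (cyc-+n 0) ⟩
    ι -1ℤ k ℤ.+ ι 1ℤ k
      ≡⟨ single-+ 𝟘 -1ℤ 1ℤ k ⟨
    ι 0ℤ k
      ≡⟨ single-0 𝟘 k ⟩
    0ℤ ∎)
    where
    open ≡.≡-Reasoning
    0<n : 0 < n
    0<n = ℕ.n≢0⇒n>0 (ℕ.≢-nonZero⁻¹ n)
    vanishes : ∀ i → suc n ≤ i → xⁿ-1 n i ≡ 0ℤ
    vanishes i 1+n≤i = xⁿ-1-other n i (ℕ.<-≤-trans 0<n (ℕ.<⇒≤ 1+n≤i)) (λ i≡n → ℕ.<-irrefl (≡.sym i≡n) 1+n≤i)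
    middle : ∀ i → 0 < i → i < n → xⁿ-1 n i ≡ 0ℤ
    middle i 0<i i<n = xⁿ-1-other n i 0<i (λ i≡n → ℕ.<-irrefl i≡n i<n)

  residue-mod : ∀ L {t u q} → (∀ i → t i ≡ u i [mod q ]) → residue L t ≡ residue L u ⟨mod ι (+ q) ⟩
  residue-mod L {t} {u} {q} t≡u = witness (residue L w) (begin
    residue L t                                ≈⟨ residue-cong L (λ i _ → ℤMod._≡_⟨mod_⟩.equation ([mod]⇒⟨mod⟩ {t i} {u i} {q} (t≡u i))) ⟩
    residue L (λ i → u i ℤ.+ + q ℤ.* w i)      ≈⟨ residue-+ L u (λ i → + q ℤ.* w i) ⟩
    residue L u + residue L (λ i → + q ℤ.* w i)   ≈⟨ +-congˡ (residue-*ˡ L (+ q) w) ⟩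
    residue L u + ι (+ q) * residue L w           ∎)
    where
    open import Relation.Binary.Reasoning.Setoid setoid
    w : ℕ → ℤ
    w i = ℤMod._≡_⟨mod_⟩.factor ([mod]⇒⟨mod⟩ {t i} {u i} {q} (t≡u i))

  reduce-mod : ∀ f g {q} → (∀ k → coeff f k ≡ coeff g k [mod q ]) → reduce n f ≡ reduce n g ⟨mod ι (+ q) ⟩
  reduce-mod f g f≡g = mod-resp (sym (reduce≈residue f (ℕ.m≤m+n (length f) (length g))))
                                (sym (reduce≈residue g (ℕ.m≤n+m (length g) (length f))))
                                (residue-mod (length f ℕ.+ length g) f≡g)

  reduce-annihilates : ∀ F G {q} → (∀ k → mulCoeff F G k ≡ xⁿ-1 n k [mod q ]) →
                       reduce n F * reduce n G ≡ 0# ⟨mod ι (+ q) ⟩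
  reduce-annihilates F G {q} FG≡Xⁿ-1 =
    mod-resp (sym FG≈) (residue-Xⁿ-1 (ℕ.m≤n+m (suc n) L)) (residue-mod (L ℕ.+ suc n) {mulCoeff F G} {xⁿ-1 n} {q} FG≡Xⁿ-1)
    where
    L = length F ℕ.+ length G
    FG≈ : reduce n F * reduce n G ≈ residue (L ℕ.+ suc n) (mulCoeff F G)
    FG≈ = trans (reduce-* F G) (sym (residue-extend (mulCoeff F G) (λ i → mulCoeff-vanishes F G) (ℕ.m≤m+n L (suc n))))

  reduce-bezout : ∀ F G {q} → (∀ k → mulCoeff F G k ≡ xⁿ-1 n k [mod q ]) →
                  reduce n (weight (ℤ.- + n) 0 G) * reduce n F + reduce n (weight 0ℤ 0 F) * reduce n G
                    ≡ ι (+ n) ⟨mod ι (+ q) ⟩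
  -- (X d/dX − n)(F G) ≡ (X d/dX − n)(Xⁿ − 1) = n, expanded by the product rule.
  reduce-bezout F G {q} FG≡Xⁿ-1 = mod-resp (sym combination≈) concentrated (residue-mod L {t} {u} {q} t≡u)
    where
    open import Relation.Binary.Reasoning.Setoid setoid
    A = weight 0ℤ 0 F
    B = weight (ℤ.- + n) 0 G
    L₁ = length F ℕ.+ length B
    L₂ = length A ℕ.+ length G
    L = suc (L₁ ℕ.+ L₂)
    c : ℕ → ℤ
    c k = + k ℤ.+ 0ℤ ℤ.+ ℤ.- + n
    t u : ℕ → ℤ
    t k = c k ℤ.* mulCoeff F G k
    u k = c k ℤ.* xⁿ-1 n k
    combination≈ : reduce n B * reduce n F + reduce n A * reduce n G ≈ residue L t
    combination≈ = begin
      reduce n B * reduce n F + reduce n A * reduce n G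
        ≈⟨ +-cong (trans (*-comm (reduce n B) (reduce n F)) (reduce-* F B)) (reduce-* A G) ⟩
      residue L₁ (mulCoeff F B) + residue L₂ (mulCoeff A G)
        ≈⟨ +-cong (residue-extend (mulCoeff F B) (λ i → mulCoeff-vanishes F B) (ℕ.≤-trans (ℕ.m≤m+n L₁ L₂) (ℕ.n≤1+n _)))
                  (residue-extend (mulCoeff A G) (λ i → mulCoeff-vanishes A G) (ℕ.≤-trans (ℕ.m≤n+m L₂ L₁) (ℕ.n≤1+n _))) ⟨
      residue L (mulCoeff F B) + residue L (mulCoeff A G)
        ≈⟨ +-comm _ _ ⟩
      residue L (mulCoeff A G) + residue L (mulCoeff F B)
        ≈⟨ residue-+ L (mulCoeff A G) (mulCoeff F B) ⟨
      residue L (λ k → mulCoeff A G k ℤ.+ mulCoeff F B k)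
        ≈⟨ residue-cong L (λ k _ → mulCoeff-weight 0ℤ (ℤ.- + n) F G k) ⟩
      residue L t
        ∎
    t≡u : ∀ k → t k ≡ u k [mod q ]
    t≡u k = ⟨mod⟩⇒[mod] (ℤMod.mod-*ˡ (c k) ([mod]⇒⟨mod⟩ {mulCoeff F G k} {xⁿ-1 n k} {q} (FG≡Xⁿ-1 k)))
    u0≡n : u 0 ≡ + n
    u0≡n = ≡.trans (≡.cong (c 0 ℤ.*_) (xⁿ-1-zero n)) (negate-twice (+ n))
      where
      negate-twice : ∀ x → (+ 0 ℤ.+ 0ℤ ℤ.+ ℤ.- x) ℤ.* -1ℤ ≡ x
      negate-twice = solve-∀
    u≡0 : ∀ k → 0 < k → k < L → u k ≡ 0ℤ
    u≡0 k 0<k _ with k ℕ.≟ n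
    ... | yes ≡.refl = ≡.trans (≡.cong (c n ℤ.*_) (xⁿ-1-n n)) (cancel (+ n))
      where
      cancel : ∀ x → (x ℤ.+ 0ℤ ℤ.+ ℤ.- x) ℤ.* 1ℤ ≡ 0ℤ
      cancel = solve-∀
    ... | no k≢n = ≡.trans (≡.cong (c k ℤ.*_) (xⁿ-1-other n k 0<k k≢n)) (ℤ.*-zeroʳ (c k))
    concentrated : residue L u ≈ ι (+ n)
    concentrated = trans (residue-concentrated L u (ℕ.s≤s ℕ.z≤n) u≡0) (ι-cong u0≡n)

-- Extended codes

infixl 5 _∷ʳ_

_∷ʳ_ : ∀ {a} {A : Set a} {n} → Vector A n → A → Vector A (suc n)
_∷ʳ_ {n = zero}  xs x _           = x
_∷ʳ_ {n = suc n} xs x Fin.zero    = xs Fin.zero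
_∷ʳ_ {n = suc n} xs x (Fin.suc i) = (xs ∘ Fin.suc ∷ʳ x) i

module _ {a} {A : Set a} where

  init-∷ʳ : ∀ {n} (xs : Vector A n) x → init (xs ∷ʳ x) ≗ xs
  init-∷ʳ {suc n} xs x Fin.zero    = ≡.refl
  init-∷ʳ {suc n} xs x (Fin.suc i) = init-∷ʳ (xs ∘ Fin.suc) x i

  last-∷ʳ : ∀ {n} (xs : Vector A n) x → last (xs ∷ʳ x) ≡ x
  last-∷ʳ {zero}  xs x = ≡.refl
  last-∷ʳ {suc n} xs x = last-∷ʳ (xs ∘ Fin.suc) x

sumFin-cong : ∀ n {u v} → u ≗ v → sumFin n u ≡ sumFin n v
sumFin-cong n {u} {v} u≗v = ≡.trans (sumFin≡∑ n u) (≡.trans (ℤΣ.sum-cong-≗ {n} u≗v) (≡.sym (sumFin≡∑ n v)))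

sumFin-+ : ∀ n u v → sumFin n (u +v v) ≡ sumFin n u ℤ.+ sumFin n v
sumFin-+ n u v = ≡.trans (sumFin≡∑ n _) (≡.trans (ℤΣ.∑-distrib-+ u v) (≡.sym (≡.cong₂ ℤ._+_ (sumFin≡∑ n u) (sumFin≡∑ n v))))

sumFin-· : ∀ n k u → sumFin n (k ·v u) ≡ k ℤ.* sumFin n u
sumFin-· n k u = ≡.trans (sumFin≡∑ n _) (≡.trans (≡.sym (ℤΣ.*-distribˡ-sum k u)) (≡.cong (k ℤ.*_) (≡.sym (sumFin≡∑ n u))))

sumFin-neg : ∀ n u → sumFin n (λ i → ℤ.- u i) ≡ ℤ.- sumFin n u
sumFin-neg n u = ≡.trans (sumFin-cong n (λ i → ≡.sym (ℤ.-1*i≡-i (u i)))) (≡.trans (sumFin-· n (ℤ.- + 1) u) (ℤ.-1*i≡-i _))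

sumFin-- : ∀ n u v → sumFin n (u -v v) ≡ sumFin n u ℤ.- sumFin n v
sumFin-- n u v = ≡.trans (sumFin-+ n u (λ i → ℤ.- v i)) (≡.cong (λ s → sumFin n u ℤ.+ s) (sumFin-neg n v))

module CyclicShift (n : ℕ) .{{_ : NonZero n}} where

  open CyclicIndex n

  sumFin-σcyc : ∀ v → sumFin n (σcyc n v) ≡ sumFin n v
  sumFin-σcyc v = begin
    sumFin n (σcyc n v)              ≡⟨ sumFin-cong n (λ k → ≡.cong v (cyc-pred k)) ⟩
    sumFin n (λ k → v (k ⊖ 𝟙))       ≡⟨ sumFin≡∑ n _ ⟩
    ℤΣ.sum (λ k → v (k ⊖ 𝟙))         ≡⟨ ℤΣ.∑-permute v (Perm.flip (rotation 𝟙)) ⟨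
    ℤΣ.sum v                         ≡⟨ sumFin≡∑ n v ⟨
    sumFin n v                       ∎
    where open ≡.≡-Reasoning

  init-σext : ∀ x → init (σext n x) ≗ σcyc n (init x)
  init-σext x i with toℕ (inject₁ i) ℕ.<? n
  ... | yes _ = ≡.cong (λ t → x (inject₁ (cyc n (t ℕ.+ n ∸ 1)))) (Fin.toℕ-inject₁ i)
  ... | no i≮n = contradiction (≡.subst (ℕ._< n) (≡.sym (Fin.toℕ-inject₁ i)) (Fin.toℕ<n i)) i≮n

  last-σext : ∀ x → last (σext n x) ≡ last x
  last-σext x with toℕ (fromℕ n) ℕ.<? n
  ... | yes n<n = contradiction (≡.subst (ℕ._< n) (Fin.toℕ-fromℕ n) n<n) (ℕ.<-irrefl ≡.refl)
  ... | no _ = ≡.refl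

≡⇒[mod] : ∀ {a b q} → a ≡ b → a ≡ b [mod q ]
≡⇒[mod] a≡b = ⟨mod⟩⇒[mod] (ℤMod.≈⇒mod a≡b)

module _ {p n : ℕ} .{{_ : NonZero n}} {C : Code n} (C-cyclic : IsCyclicCode p n C) where

  open IsCyclicCode C-cyclic

  cyclic-resp : ∀ {x y} → x ≗ y → C x → C y
  cyclic-resp x≗y = respects _ _ (λ i → ≡⇒[mod] (x≗y i))

  cyclic-diff-trans : ∀ {a b c} → C (a -v b) → C (b -v c) → C (a -v c)
  cyclic-diff-trans {a} {b} {c} Ca-b Cb-c = cyclic-resp (λ i → telescope (a i) (b i) (c i)) (+-closed _ _ Ca-b Cb-c)
    where
    telescope : ∀ x y z → x ℤ.- y ℤ.+ (y ℤ.- z) ≡ x ℤ.- z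
    telescope = solve-∀

module ExtendedVectors (n : ℕ) .{{_ : NonZero n}} where

  open CyclicShift n

  ext : Vecℤ n → Vecℤ (suc n)
  ext u = u ∷ʳ ℤ.- sumFin n u

  ext-diff-∈ : ∀ {r X} → (∀ {x y} → x ≗ y → X x → X y) → ∀ a y → X (a -v init y) →
               last y ≡ ℤ.- sumFin n (init y) [mod r ] → extCode r n X (ext a -v y)
  ext-diff-∈ {r} {X} X-resp a y X[a-y] y-last =
    X-resp (λ i → ≡.cong (ℤ._- y (inject₁ i)) (≡.sym (init-∷ʳ a _ i))) X[a-y] ,
    ⟨mod⟩⇒[mod] (ℤMod.mod-trans (ℤMod.mod-- (ℤMod.≈⇒mod (last-∷ʳ a _)) ([mod]⇒⟨mod⟩ {last y} {_} {r} y-last))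
                                 (ℤMod.≈⇒mod (≡.trans (negate-diff (sumFin n a) (sumFin n (init y)))
                                   (≡.cong ℤ.-_ (≡.trans (≡.sym (sumFin-- n a (init y)))
                                     (sumFin-cong n (λ i → ≡.cong (ℤ._- y (inject₁ i)) (≡.sym (init-∷ʳ a _ i)))))))))
    where
    negate-diff : ∀ x y → ℤ.- x ℤ.- ℤ.- y ≡ ℤ.- (x ℤ.- y)
    negate-diff = solve-∀

  Extended : Vecℤ (suc n) → Set
  Extended y = last y ≡ ℤ.- sumFin n (init y)

  Extended-ext : ∀ b → Extended (ext b)
  Extended-ext b = ≡.trans (last-∷ʳ b _) (≡.cong ℤ.-_ (sumFin-cong n (λ i → ≡.sym (init-∷ʳ b _ i))))

  Extended-+ : ∀ {y y′} → Extended y → Extended y′ → Extended (y +v y′)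
  Extended-+ {y} {y′} ext-y ext-y′ = ≡.trans (≡.cong₂ ℤ._+_ ext-y ext-y′)
    (≡.trans (≡.sym (ℤ.neg-distrib-+ (sumFin n (init y)) (sumFin n (init y′)))) (≡.cong ℤ.-_ (≡.sym (sumFin-+ n (init y) (init y′)))))

  Extended-· : ∀ k {y} → Extended y → Extended (k ·v y)
  Extended-· k {y} ext-y = ≡.trans (≡.cong (k ℤ.*_) ext-y)
    (≡.trans (≡.sym (ℤ.neg-distribʳ-* k (sumFin n (init y)))) (≡.cong ℤ.-_ (≡.sym (sumFin-· n k (init y)))))

  Extended-σ : ∀ {y} → Extended y → Extended (σext n y)
  Extended-σ {y} ext-y = ≡.trans (last-σext y) (≡.trans ext-y (≡.cong ℤ.-_ (≡.trans (≡.sym (sumFin-σcyc (init y)))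
    (sumFin-cong n (λ i → ≡.sym (init-σext y i))))))

  ext-∈ : ∀ {r X} → (∀ {x y} → x ≗ y → X x → X y) → ∀ {a} → X a → extCode r n X (ext a)
  ext-∈ X-resp {a} Xa = X-resp (λ i → ≡.sym (init-∷ʳ a _ i)) Xa , ≡⇒[mod] (Extended-ext a)

module Extension {p q m n : ℕ} .{{_ : NonZero n}} {B A : Code n} {D C : Fin m → Code n}
  (B-resp : ∀ {x y} → x ≗ y → B x → B y)
  (A-null : ∀ {x} → x ≗ 0v → A x)
  (D-resp : ∀ j {x y} → x ≗ y → D j x → D j y)
  (C-cyclic : ∀ j → IsCyclicCode p n (C j))
  (iso : Iso (quotient n (σcyc n) B A) (directSum m n (σcyc n) D C))
  where

  open CyclicShift n
  open ExtendedVectors n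

  private
    module I = Iso iso
    C-resp : ∀ j {x y} → x ≗ y → C j x → C j y
    C-resp j = cyclic-resp (C-cyclic j)

    extC-diff : ∀ j a b y → C j (a -v b) → init y ≗ b → Extended y → extCode p n (C j) (ext a -v y)
    extC-diff j a b y Ca-b init-y≗b ext-y =
      ext-diff-∈ (C-resp j) a y (C-resp j (λ i → ≡.cong (λ t → a i ℤ.- t) (≡.sym (init-y≗b i))) Ca-b) (≡⇒[mod] ext-y)

    F : (x : Vecℤ (suc n)) → extCode q n B x → Fin m → Vecℤ (suc n)
    F x hx j = ext (I.f (init x) (proj₁ hx) j)

  extendedIso : Iso (quotient (suc n) (σext n) (extCode q n B) (extCode q n A))
                    (directSum m (suc n) (σext n) (λ j → extCode p n (D j)) (λ j → extCode p n (C j)))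
  extendedIso = record
    { f = F ; mem = mem ; resp = resp ; inj = inj ; surj = surj ; add = add ; scal = scal ; equi = equi }
    where
    f₀ : ∀ x → extCode q n B x → Fin m → Vecℤ n
    f₀ x hx = I.f (init x) (proj₁ hx)

    mem : ∀ x hx j → extCode p n (D j) (F x hx j)
    mem x hx j = ext-∈ (D-resp j) (I.mem (init x) (proj₁ hx) j)

    resp : ∀ x y hx hy → extCode q n A (x -v y) → ∀ j → extCode p n (C j) (F x hx j -v F y hy j)
    resp x y hx hy hxy j = extC-diff j (f₀ x hx j) (f₀ y hy j) (F y hy j)
      (I.resp (init x) (init y) (proj₁ hx) (proj₁ hy) (proj₁ hxy) j) (init-∷ʳ (f₀ y hy j) _) (Extended-ext (f₀ y hy j))

    inj : ∀ x y hx hy → (∀ j → extCode p n (C j) (F x hx j -v F y hy j)) → extCode q n A (x -v y)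
    inj x y hx hy hc =
      I.inj (init x) (init y) (proj₁ hx) (proj₁ hy)
        (λ j → C-resp j (λ i → ≡.cong₂ ℤ._-_ (init-∷ʳ (f₀ x hx j) _ i) (init-∷ʳ (f₀ y hy j) _ i)) (proj₁ (hc j))) ,
      ⟨mod⟩⇒[mod] (ℤMod.mod-trans
        (ℤMod.mod-- ([mod]⇒⟨mod⟩ {last x} {_} {q} (proj₂ hx)) ([mod]⇒⟨mod⟩ {last y} {_} {q} (proj₂ hy)))
        (ℤMod.≈⇒mod (≡.trans (negate-diff (sumFin n (init x)) (sumFin n (init y)))
                               (≡.cong ℤ.-_ (≡.sym (sumFin-- n (init x) (init y)))))))
      where
      negate-diff : ∀ a b → ℤ.- a ℤ.- ℤ.- b ≡ ℤ.- (a ℤ.- b)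
      negate-diff = solve-∀

    -- The cyclic map depends on the membership proof; surj and equi compare two proofs by I.resp.
    surj : ∀ y → (∀ j → extCode p n (D j) (y j)) →
           Σ (Vecℤ (suc n)) λ x → Σ (extCode q n B x) λ hx → ∀ j → extCode p n (C j) (F x hx j -v y j)
    surj y hy = ext x , hx′ , λ j → ext-diff-∈ (C-resp j) (f₀ (ext x) hx′ j) (y j)
        (cyclic-diff-trans (C-cyclic j) {f₀ (ext x) hx′ j} {I.f x hx j} {init (y j)}
          (I.resp _ x (proj₁ hx′) hx (A-null x′-x≗0) j) (Cfx-y j)) (proj₂ (hy j))
      where
      x = proj₁ (I.surj (init ∘ y) (proj₁ ∘ hy))
      hx = proj₁ (proj₂ (I.surj (init ∘ y) (proj₁ ∘ hy)))
      Cfx-y = proj₂ (proj₂ (I.surj (init ∘ y) (proj₁ ∘ hy)))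
      hx′ : extCode q n B (ext x)
      hx′ = ext-∈ B-resp hx
      x′-x≗0 : init (ext x) -v x ≗ 0v
      x′-x≗0 i = ≡.trans (≡.cong (ℤ._- x i) (init-∷ʳ x _ i)) (ℤ.+-inverseʳ (x i))

    add : ∀ x y hx hy hxy j → extCode p n (C j) (F (x +v y) hxy j -v (F x hx j +v F y hy j))
    add x y hx hy hxy j = extC-diff j (f₀ (x +v y) hxy j) (f₀ x hx j +v f₀ y hy j) (F x hx j +v F y hy j)
      (I.add (init x) (init y) (proj₁ hx) (proj₁ hy) (proj₁ hxy) j)
      (λ i → ≡.cong₂ ℤ._+_ (init-∷ʳ (f₀ x hx j) _ i) (init-∷ʳ (f₀ y hy j) _ i))
        (Extended-+ {F x hx j} {F y hy j} (Extended-ext (f₀ x hx j)) (Extended-ext (f₀ y hy j)))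

    scal : ∀ k x hx hkx j → extCode p n (C j) (F (k ·v x) hkx j -v (k ·v F x hx j))
    scal k x hx hkx j = extC-diff j (f₀ (k ·v x) hkx j) (k ·v f₀ x hx j) (k ·v F x hx j)
      (I.scal k (init x) (proj₁ hx) (proj₁ hkx) j)
      (λ i → ≡.cong (k ℤ.*_) (init-∷ʳ (f₀ x hx j) _ i)) (Extended-· k {F x hx j} (Extended-ext (f₀ x hx j)))

    equi : ∀ x hx hσx j → extCode p n (C j) (F (σext n x) hσx j -v σext n (F x hx j))
    equi x hx hσx j = extC-diff j (f₀ (σext n x) hσx j) (σcyc n (f₀ x hx j)) (σext n (F x hx j))
      (cyclic-diff-trans (C-cyclic j) {f₀ (σext n x) hσx j} {I.f (σcyc n (init x)) hσx′ j} {σcyc n (f₀ x hx j)}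
        (I.resp _ _ (proj₁ hσx) hσx′ (A-null σ-init≗0) j) (I.equi (init x) (proj₁ hx) hσx′ j))
      (λ i → ≡.trans (init-σext (F x hx j) i) (init-∷ʳ (f₀ x hx j) _ _)) (Extended-σ {F x hx j} (Extended-ext (f₀ x hx j)))
      where
      hσx′ : B (σcyc n (init x))
      hσx′ = B-resp (init-σext x) (proj₁ hσx)
      σ-init≗0 : init (σext n x) -v σcyc n (init x) ≗ 0v
      σ-init≗0 i = ≡.trans (≡.cong (ℤ._- σcyc n (init x) i) (init-σext x i)) (ℤ.+-inverseʳ (σcyc n (init x) i))

open import Data.Nat.Divisibility using (_∣_)

-- Lifted codes

prime-coprime : ∀ {p n} → Prime p → ¬ (p ∣ n) → Coprime p n
prime-coprime prime p∤n (d∣p , d∣n) with prime⇒irreducible prime d∣p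
... | inj₁ d≡1 = d≡1
... | inj₂ ≡.refl = ⊥-elim (p∤n d∣n)

inverse-mod : ∀ {p n} → Coprime p n → ∃ λ u → ℤMod._≡_⟨mod_⟩ (u ℤ.* + n) 1ℤ (+ p)
inverse-mod {p} {n} p⊥n with coprime-Bézout p⊥n
... | GCD.Bézout.+- x y 1+yn≡xp = ℤ.- + y , ℤMod.witness (ℤ.- + x) (begin
  ℤ.- + y ℤ.* + n                    ≡⟨ -yn≡1-[1+yn] (+ y) (+ n) ⟩
  1ℤ ℤ.- (1ℤ ℤ.+ + y ℤ.* + n)         ≡⟨ ≡.cong (λ t → 1ℤ ℤ.- t) (≡.trans (≡.cong (λ t → 1ℤ ℤ.+ t) (≡.sym (ℤ.pos-* y n)))
                                          (≡.trans (≡.sym (ℤ.pos-+ 1 (y ℕ.* n))) (≡.trans (≡.cong +_ 1+yn≡xp) (ℤ.pos-* x p)))) ⟩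
  1ℤ ℤ.- + x ℤ.* + p                  ≡⟨ 1-xp≡1+p[-x] (+ x) (+ p) ⟩
  1ℤ ℤ.+ + p ℤ.* ℤ.- + x              ∎)
  where
  open ≡.≡-Reasoning
  -yn≡1-[1+yn] : ∀ y n → ℤ.- y ℤ.* n ≡ 1ℤ ℤ.- (1ℤ ℤ.+ y ℤ.* n)
  -yn≡1-[1+yn] = solve-∀
  1-xp≡1+p[-x] : ∀ x p → 1ℤ ℤ.- x ℤ.* p ≡ 1ℤ ℤ.+ p ℤ.* ℤ.- x
  1-xp≡1+p[-x] = solve-∀
... | GCD.Bézout.-+ x y 1+xp≡yn = + y , ℤMod.witness (+ x) (begin
  + y ℤ.* + n         ≡⟨ ℤ.pos-* y n ⟨
  + (y ℕ.* n)         ≡⟨ ≡.cong +_ 1+xp≡yn ⟨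
  + (1 ℕ.+ x ℕ.* p)   ≡⟨ ≡.trans (ℤ.pos-+ 1 (x ℕ.* p)) (≡.cong (λ t → 1ℤ ℤ.+ t) (≡.trans (ℤ.pos-* x p) (ℤ.*-comm (+ x) (+ p)))) ⟩
  1ℤ ℤ.+ + p ℤ.* + x  ∎)
  where open ≡.≡-Reasoning

quotient-iso-refl : ∀ {N s} {B A : Code N} → (∀ x → A (x -v x)) → Iso (quotient N s B A) (quotient N s B A)
quotient-iso-refl {s = s} A-diag = record
  { f = λ x _ → x
  ; mem = λ _ hx → hx
  ; resp = λ _ _ _ _ x≈y → x≈y
  ; inj = λ _ _ _ _ x≈y → x≈y
  ; surj = λ y hy → y , hy , A-diag y
  ; add = λ x y _ _ _ → A-diag (x +v y)
  ; scal = λ k x _ _ → A-diag (k ·v x)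
  ; equi = λ x _ _ → A-diag (s x)
  }

module LiftedCodes (p m n : ℕ) .{{_ : NonZero n}} (prime : Prime p) (1≤m : 1 ≤ m) (p∤n : ¬ (p ∣ n)) where

  open CyclicIndex n
  open Convolution n
  open Polynomials n
  open ℤAlgebra ℤ[X]/⟨Xⁿ-1⟩ ι-hom
  open _-Raw-AlmostCommutative⟶_ ι-hom using (+-homo; *-homo)
  open import Relation.Binary.Reasoning.Setoid setoid

  P ν : Vecℤ n
  P = ι (+ p)
  ν = ι (+ n)

  ι-mod : ∀ {a b q} → ℤMod._≡_⟨mod_⟩ a b (+ q) → ι a ≡ ι b ⟨mod ι (+ q) ⟩
  ι-mod {a} {b} {q} (ℤMod.witness w a≡b+qw) = witness (ι w) (begin
    ι a                      ≈⟨ ι-cong a≡b+qw ⟩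
    ι (b ℤ.+ + q ℤ.* w)      ≈⟨ +-homo b (+ q ℤ.* w) ⟩
    ι b + ι (+ q ℤ.* w)      ≈⟨ +-congˡ (*-homo (+ q) w) ⟩
    ι b + ι (+ q) * ι w      ∎)

  ≡v⇒mod : ∀ {q} x y → x ≡v y [mod q ] → x ≡ y ⟨mod ι (+ q) ⟩
  ≡v⇒mod {q} x y x≡y = witness w (λ k → ≡.trans (ℤMod._≡_⟨mod_⟩.equation (x≡y′ k))
    (≡.trans (≡.cong (λ t → y k ℤ.+ t) (≡.sym (ι-⊛ (+ q) w k))) (≡.sym (⊞≗+v y (ι (+ q) * w) k))))
    where
    x≡y′ : ∀ k → ℤMod._≡_⟨mod_⟩ (x k) (y k) (+ q)
    x≡y′ k = [mod]⇒⟨mod⟩ {x k} {y k} {q} (x≡y k)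
    w : Vecℤ n
    w k = ℤMod._≡_⟨mod_⟩.factor (x≡y′ k)

  mod⇒≡v : ∀ {q} x y → x ≡ y ⟨mod ι (+ q) ⟩ → x ≡v y [mod q ]
  mod⇒≡v {q} x y (witness w x≈y+qw) k = ⟨mod⟩⇒[mod] (ℤMod.witness (w k)
    (≡.trans (x≈y+qw k) (≡.trans (⊞≗+v y (ι (+ q) * w) k) (≡.cong (λ t → y k ℤ.+ t) (ι-⊛ (+ q) w k)))))

  P^≈ι : ∀ e → P ^ e ≈ ι (+ (p ℕ.^ e))
  P^≈ι zero = refl
  P^≈ι (suc e) = begin
    P * P ^ e                       ≈⟨ *-congˡ (P^≈ι e) ⟩
    ι (+ p) * ι (+ (p ℕ.^ e))       ≈⟨ *-homo (+ p) (+ (p ℕ.^ e)) ⟨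
    ι (+ p ℤ.* + (p ℕ.^ e))         ≈⟨ ι-cong (ℤ.pos-* p (p ℕ.^ e)) ⟨
    ι (+ (p ℕ.^ suc e))             ∎

  P-regular : Regular P
  P-regular x Px≈0 k with ℤ.i*j≡0⇒i≡0∨j≡0 (+ p) (≡.trans (≡.sym (ι-⊛ (+ p) x k)) (Px≈0 k))
  ... | inj₁ p≡0 = ⊥-elim (ℕ.≢-nonZero⁻¹ p {{prime⇒nonZero prime}} (ℤ.+-injective p≡0))
  ... | inj₂ xk≡0 = xk≡0

  ν-unit-mod-P : ∃ λ u → u * ν ≡ 1# ⟨mod P ⟩
  ν-unit-mod-P = lift-inverse (inverse-mod (prime-coprime prime p∤n))
    where
    lift-inverse : (∃ λ u → ℤMod._≡_⟨mod_⟩ (u ℤ.* + n) 1ℤ (+ p)) → ∃ λ u → u * ν ≡ 1# ⟨mod P ⟩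
    lift-inverse (u , un≡1) = ι u , mod-resp (*-homo u (+ n)) refl (ι-mod un≡1)

  open CoprimeFactors P ν P-regular ν-unit-mod-P

  mod-ι[p^m]⇒mod-P : ∀ {x y} → x ≡ y ⟨mod ι (+ (p ℕ.^ m)) ⟩ → x ≡ y ⟨mod P ⟩
  mod-ι[p^m]⇒mod-P = mod-modulus-≈ (*-identityʳ P) ∘ mod-∣ (^-mono-∣ P 1≤m) ∘ mod-modulus-≈ (sym (P^≈ι m))

  module _ {g G : List ℤ} (G-lift : IsHenselLift p m n g G) where

    cofactor : List ℤ
    cofactor = proj₁ (proj₁ (proj₂ G-lift))

    private
      G*cofactor≡Xⁿ-1 : ∀ k → mulCoeff G cofactor k ≡ xⁿ-1 n k [mod p ℕ.^ m ]
      G*cofactor≡Xⁿ-1 = proj₂ (proj₁ (proj₂ G-lift))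

    lift-annihilates : reduce n G * reduce n cofactor ≡ 0# ⟨mod P ^ m ⟩
    lift-annihilates = mod-modulus-≈ (sym (P^≈ι m)) (reduce-annihilates G cofactor G*cofactor≡Xⁿ-1)

    lift-bezout : Bezout (reduce n G) (reduce n cofactor)
    lift-bezout = bezout _ _ (mod-ι[p^m]⇒mod-P (reduce-bezout G cofactor G*cofactor≡Xⁿ-1))

    generator≡lift : reduce n g ≡ reduce n G ⟨mod P ⟩
    generator≡lift = mod-sym (reduce-mod G g (proj₂ (proj₂ G-lift)))

  module _ {C : Code n} {g G : List ℤ} (g-gen : IsGeneratorPoly p n C g) (G-lift : IsHenselLift p m n g G) where

    private
      conv≈ : ∀ h → conv n (reduce n g) h ≈ reduce n g * h
      conv≈ h k = ≡.sym (⊛≗conv (reduce n g) h k)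

    ∈⇒∣ : ∀ {x} → C x → reduce n G ∣ x ⟨mod P ⟩
    ∈⇒∣ {x} Cx = h , mod-trans (mod-resp refl (conv≈ h) (≡v⇒mod x _ x≡gh)) (mod-*ʳ h (generator≡lift {g} {G} G-lift))
      where
      h = proj₁ (proj₁ (proj₂ (proj₂ g-gen) x) Cx)
      x≡gh = proj₂ (proj₁ (proj₂ (proj₂ g-gen) x) Cx)

    ∣⇒∈ : ∀ {x} → reduce n G ∣ x ⟨mod P ⟩ → C x
    ∣⇒∈ {x} (h , x≡Gh) = proj₂ (proj₂ (proj₂ g-gen) x)
      (h , mod⇒≡v x _ (mod-resp refl (sym (conv≈ h)) (mod-trans x≡Gh (mod-*ʳ h (mod-sym (generator≡lift {g} {G} G-lift))))))

  +v≈+ : ∀ x y → x +v y ≈ x + y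
  +v≈+ x y k = ≡.sym (⊞≗+v x y k)

  -v≈- : ∀ x y → x -v y ≈ x - y
  -v≈- x y k = ≡.trans (≡.cong (λ t → x k ℤ.+ t) (≡.sym (⊟-apply y k))) (≡.sym (⊞≗+v x (- y) k))

  ·v≈ι* : ∀ a x → a ·v x ≈ ι a * x
  ·v≈ι* a x k = ≡.sym (ι-⊛ a x k)

  σ≈X* : ∀ x → σcyc n x ≈ X * x
  σ≈X* x k = ≡.sym (X-⊛ x k)

  ∑-apply : ∀ {l} (f : Fin l → Vecℤ n) k → sum f k ≡ sumFin l (λ j → f j k)
  ∑-apply {zero} f k = ≡.refl
  ∑-apply {suc l} f k = ≡.trans (⊞≗+v (f Fin.zero) (sum (f ∘ Fin.suc)) k) (≡.cong (λ t → f Fin.zero k ℤ.+ t) (∑-apply (f ∘ Fin.suc) k))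

  module CodeChains
    (C D : Fin m → Code n)
    (C-cyclic : ∀ j → IsCyclicCode p n (C j)) (D-cyclic : ∀ j → IsCyclicCode p n (D j))
    (g h : Fin m → List ℤ)
    (g-gen : ∀ j → IsGeneratorPoly p n (C j) (g j)) (h-gen : ∀ j → IsGeneratorPoly p n (D j) (h j))
    (G H : Fin m → List ℤ)
    (G-lift : ∀ j → IsHenselLift p m n (g j) (G j)) (H-lift : ∀ j → IsHenselLift p m n (h j) (H j))
    (C⊆D : ∀ i → C i ⊆ D i) (D⊆C : ∀ i j → toℕ j ≡ suc (toℕ i) → D i ⊆ C j)
    where

    G′ H′ K′ L′ : Fin m → Vecℤ n
    G′ j = reduce n (G j)
    H′ j = reduce n (H j)
    K′ j = reduce n (cofactor {h j} {H j} (H-lift j))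
    L′ j = reduce n (cofactor {g j} {G j} (G-lift j))

    C∣ : ∀ j {x} → C j x → G′ j ∣ x ⟨mod P ⟩
    C∣ j = ∈⇒∣ {C j} {g j} {G j} (g-gen j) (G-lift j)
    ∣C : ∀ j {x} → G′ j ∣ x ⟨mod P ⟩ → C j x
    ∣C j = ∣⇒∈ {C j} {g j} {G j} (g-gen j) (G-lift j)
    D∣ : ∀ j {x} → D j x → H′ j ∣ x ⟨mod P ⟩
    D∣ j = ∈⇒∣ {D j} {h j} {H j} (h-gen j) (H-lift j)
    ∣D : ∀ j {x} → H′ j ∣ x ⟨mod P ⟩ → D j x
    ∣D j = ∣⇒∈ {D j} {h j} {H j} (h-gen j) (H-lift j)

    open LiftedChain m G′ H′ K′ L′
      (λ j → lift-annihilates {h j} {H j} (H-lift j)) (λ j → lift-annihilates {g j} {G j} (G-lift j))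
      (λ j → lift-bezout {h j} {H j} (H-lift j)) (λ j → lift-bezout {g j} {G j} (G-lift j))
      (λ i G∣x → D∣ i (C⊆D i _ (∣C i G∣x)))
      (λ i j j≡1+i H∣x → C∣ j (D⊆C i j j≡1+i _ (∣D i H∣x)))

    lift-apply : ∀ (Fs : Fin m → List ℤ) (u : Fin m → Vecℤ n) → lift (λ j → reduce n (Fs j)) u ≗ λ k → sumFin m
      (λ j → + (p ℕ.^ toℕ j) ℤ.* conv n (reduce n (Fs j)) (u j) k)
    lift-apply Fs u k = ≡.trans (∑-apply (λ j → P ^ toℕ j * (reduce n (Fs j) * u j)) k) (sumFin-cong m (λ j →
      ≡.trans (*-congʳ {reduce n (Fs j) * u j} (P^≈ι (toℕ j)) k)
        (≡.trans (ι-⊛ (+ (p ℕ.^ toℕ j)) (reduce n (Fs j) * u j) k) (≡.cong (+ (p ℕ.^ toℕ j) ℤ.*_) (⊛≗conv (reduce n (Fs j)) (u j) k)))))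

    liftCode⇒≡lift : ∀ (Fs : Fin m → List ℤ) {x} (hx : liftCode p m n Fs x) → x ≡ lift (λ j → reduce n (Fs j)) (proj₁ hx) ⟨mod P ^ m ⟩
    liftCode⇒≡lift Fs {x} (u , x≡) = mod-modulus-≈ (sym (P^≈ι m)) (mod-resp refl (λ k → ≡.sym (lift-apply Fs u k)) (≡v⇒mod x _ x≡))

    ≡lift⇒liftCode : ∀ (Fs : Fin m → List ℤ) {x} u → x ≡ lift (λ j → reduce n (Fs j)) u ⟨mod P ^ m ⟩ → liftCode p m n Fs x
    ≡lift⇒liftCode Fs {x} u x≡ = u , mod⇒≡v x _ (mod-resp refl (lift-apply Fs u) (mod-modulus-≈ (P^≈ι m) x≡))

    liftCode-G⇒LiftIdeal : ∀ {x} → liftCode p m n G x → LiftIdeal x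
    liftCode-G⇒LiftIdeal hx = proj₁ hx , liftCode⇒≡lift G hx

    LiftIdeal⇒liftCode-G : ∀ {x} → LiftIdeal x → liftCode p m n G x
    LiftIdeal⇒liftCode-G (u , x≡) = ≡lift⇒liftCode G u x≡

    Φ : ∀ x → liftCode p m n H x → Fin m → Vecℤ n
    Φ x hx j = H′ j * proj₁ hx j

    private
      C-resp : ∀ j {x y} → x ≈ y → C j x → C j y
      C-resp j = cyclic-resp (C-cyclic j)

      x≡Hc : ∀ {x} (hx : liftCode p m n H x) → x ≡ lift H′ (proj₁ hx) ⟨mod P ^ m ⟩
      x≡Hc = liftCode⇒≡lift H

      diff≈ : ∀ a b → a - b ≈ a -v b
      diff≈ a b = sym (-v≈- a b)

    cyclicIso : Iso (quotient n (σcyc n) (liftCode p m n H) (liftCode p m n G)) (directSum m n (σcyc n) D C)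
    cyclicIso = record
      { f = Φ
      ; mem = λ x hx j → ∣D j (proj₁ hx j , mod-refl)
      ; resp = λ x y hx hy hxy j → C-resp j (diff≈ _ _) (∣C j
          (difference-∈LiftIdeal⇒G∣ (x≡Hc hx) (x≡Hc hy) (LiftIdeal-resp (≈⇒mod (diff≈ x y)) (liftCode-G⇒LiftIdeal hxy)) j))
      ; inj = λ x y hx hy hc → LiftIdeal⇒liftCode-G (LiftIdeal-resp (≈⇒mod (-v≈- x y))
          (G∣⇒difference-∈LiftIdeal (x≡Hc hx) (x≡Hc hy) (λ j → C∣ j (C-resp j (-v≈- _ _) (hc j)))))
      ; surj = surj
      ; add = λ x y hx hy hxy j → C-resp j (sym (trans (-v≈- _ _) (+-congˡ (-‿cong (+v≈+ _ _))))) (∣C j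
          (witness-+ (x≡Hc hx) (x≡Hc hy) (mod-resp (+v≈+ x y) refl (x≡Hc hxy)) j))
      ; scal = λ k x hx hkx j → C-resp j (sym (trans (-v≈- _ _) (+-congˡ (-‿cong (·v≈ι* k _))))) (∣C j
          (witness-* (x≡Hc hx) (mod-resp (·v≈ι* k x) refl (x≡Hc hkx)) j))
      ; equi = λ x hx hσx j → C-resp j (sym (trans (-v≈- _ _) (+-congˡ (-‿cong (σ≈X* _))))) (∣C j
          (witness-* (x≡Hc hx) (mod-resp (σ≈X* x) refl (x≡Hc hσx)) j))
      }
      where
      surj : ∀ y → (∀ j → D j (y j)) → Σ (Vecℤ n) λ x → Σ (liftCode p m n H x) λ hx → ∀ j → C j (Φ x hx j -v y j)
      surj y hy = lift H′ v , ≡lift⇒liftCode H v mod-refl , λ j → C-resp j (diff≈ _ _) (∣C j (G∣0 j))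
        where
        v : Fin m → Vecℤ n
        v j = proj₁ (D∣ j (hy j))
        G∣0 : ∀ j → G′ j ∣ H′ j * v j - y j ⟨mod P ⟩
        G∣0 j = 0# , mod-trans (mod-- mod-refl (proj₂ (D∣ j (hy j)))) (≈⇒mod (trans (-‿inverseʳ _) (sym (zeroʳ (G′ j)))))

    liftCode-resp : ∀ Fs {x y} → x ≗ y → liftCode p m n Fs x → liftCode p m n Fs y
    liftCode-resp Fs x≗y (u , x≡) = u , λ k → ≡.subst (λ a → a ≡ _ [mod p ℕ.^ m ]) (x≗y k) (x≡ k)

    liftCode-G-null : ∀ {x} → x ≗ 0v → liftCode p m n G x
    liftCode-G-null x≗0 = LiftIdeal⇒liftCode-G (LiftIdeal-resp (≈⇒mod x≗0) LiftIdeal-0)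

    liftIso : ∀ κ → Iso (quotient (Len κ n) (σ κ n) (codeOf κ (p ℕ.^ m) n (liftCode p m n H)) (codeOf κ (p ℕ.^ m) n (liftCode p m n G)))
                        (directSum m (Len κ n) (σ κ n) (λ j → codeOf κ p n (D j)) (λ j → codeOf κ p n (C j)))
    liftIso cyclic = cyclicIso
    liftIso extended = Extension.extendedIso {p} {p ℕ.^ m} (liftCode-resp H) liftCode-G-null
      (λ j → cyclic-resp (D-cyclic j)) C-cyclic cyclicIso

codeOf-null : ∀ κ {r n X} → (∀ {x} → x ≗ 0v → X x) → ∀ {v} → v ≗ 0v → codeOf κ r n X v
codeOf-null cyclic X-null v≗0 = X-null v≗0
codeOf-null extended {n = n} X-null {v} v≗0 = X-null (v≗0 ∘ Fin.inject₁) , ≡⇒[mod] (≡.trans (v≗0 (Fin.fromℕ n))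
  (≡.cong ℤ.-_ (≡.sym (≡.trans (sumFin-cong n (v≗0 ∘ Fin.inject₁)) (≡.trans (sumFin≡∑ n 0v) (ℤΣ.sum-replicate-zero n))))))

plain-inclusion : ∀ κ {p n} .{{_ : NonZero n}} {X Y : Code n} → IsCyclicCode p n X → IsCyclicCode p n Y →
                  codeOf κ p n X ⊆ codeOf κ p n Y → X ⊆ Y
plain-inclusion cyclic _ _ X⊆Y = X⊆Y
plain-inclusion extended {n = n} X-cyclic Y-cyclic X⊆Y x Xx =
  cyclic-resp Y-cyclic (init-∷ʳ x _) (proj₁ (X⊆Y (ext x) (ext-∈ (cyclic-resp X-cyclic) Xx)))
  where open ExtendedVectors n

open import Data.Nat using (_^_)

lemma2p6 : (p m n : ℕ) → .{{_ : NonZero n}} → Prime p → 1 ≤ m → ¬ (p ∣ n) →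
  (κ : Kind) →
  (C D : Fin m → Code n) →
  (∀ j → IsCyclicCode p n (C j)) → (∀ j → IsCyclicCode p n (D j)) →
  (g h : Fin m → List ℤ) →
  (∀ j → IsGeneratorPoly p n (C j) (g j)) → (∀ j → IsGeneratorPoly p n (D j) (h j)) →
  (G H : Fin m → List ℤ) →
  (∀ j → IsHenselLift p m n (g j) (G j)) → (∀ j → IsHenselLift p m n (h j) (H j)) →
  (∀ i → codeOf κ p n (C i) ⊆ codeOf κ p n (D i)) →
  (∀ i j → toℕ j ≡ suc (toℕ i) → codeOf κ p n (D i) ⊆ codeOf κ p n (C j)) →
  Iso (quotient (Len κ n) (σ κ n) (lattice (codeOf κ (p ^ m) n (liftCode p m n H)))
                                  (lattice (codeOf κ (p ^ m) n (liftCode p m n G))))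
      (quotient (Len κ n) (σ κ n) (codeOf κ (p ^ m) n (liftCode p m n H))
                                  (codeOf κ (p ^ m) n (liftCode p m n G)))
  × Iso (quotient (Len κ n) (σ κ n) (codeOf κ (p ^ m) n (liftCode p m n H))
                                    (codeOf κ (p ^ m) n (liftCode p m n G)))
        (directSum m (Len κ n) (σ κ n) (λ j → codeOf κ p n (D j)) (λ j → codeOf κ p n (C j)))
lemma2p6 p m n prime 1≤m p∤n κ C D C-cyclic D-cyclic g h g-gen h-gen G H G-lift H-lift C⊆D D⊆C =
  quotient-iso-refl {A = lifted G} lift-contains-differences , liftIso κ
  where
  open LiftedCodes p m n prime 1≤m p∤n
  open CodeChains C D C-cyclic D-cyclic g h g-gen h-gen G H G-lift H-lift
    (λ i → plain-inclusion κ (C-cyclic i) (D-cyclic i) (C⊆D i))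
    (λ i j j≡1+i → plain-inclusion κ (D-cyclic i) (C-cyclic j) (D⊆C i j j≡1+i))
  lifted : (Fin m → List ℤ) → Code (Len κ n)
  lifted F = codeOf κ (p ^ m) n (liftCode p m n F)
  lift-contains-differences : ∀ x → lifted G (x -v x)
  lift-contains-differences x = codeOf-null κ liftCode-G-null (λ i → ℤ.+-inverseʳ (x i))
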